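{- Let $\mathcal{C}$ be an idempotent-complete category, let $R,S,T$ be monads on $\mathcal{C}$, let $\lambda \colon TS \Rightarrow ST$ and $\sigma \colon SR \Rightarrow RS$ be weak distributive laws, and let $\tau \colon TR \Rightarrow RT$ be a distributive law, satisfying the Yang–Baxter equation $\sigma T \circ S\tau \circ \lambda R = R\lambda \circ \tau S \circ T\sigma$. Consider the weak distributive laws $$\phi \triangleq \pi^\sigma T \circ R\lambda \circ \tau S \circ T\iota^\sigma \colon T(R\bullet_\sigma S) \Rightarrow (R\bullet_\sigma S)T$$ and $$\psi \triangleq R\pi^\lambda \circ \sigma T \circ S\tau \circ \iota^\lambda R \colon (S\bullet_\lambda T)R \Rightarrow R(S\bullet_\lambda T).$$ Then $\phi$ and $\psi$ generate the same monad: $(R\bullet_\sigma S)\bullet_\phi T = R\bullet_\psi (S\bullet_\lambda T)$, in the sense that for any splitting of the idempotent $\kappa^\phi$ there is a splitting of $\kappa^\psi$ for which the two weak composite monads have the same underlying functor, the same unit and the same multiplication.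
   Context: $\mathcal{C}$ is idempotent complete. A monad is $(T,\eta^T,\mu^T)$. For monads $A,B$ a natural transformation $\lambda \colon BA \Rightarrow AB$ is a distributive law if it satisfies $(\eta^+)$ $\lambda \circ B\eta^A = \eta^A B$, $(\mu^+)$ $\lambda \circ B\mu^A = \mu^A B \circ A\lambda \circ \lambda A$, $(\eta^-)$ $\lambda \circ \eta^B A = A\eta^B$, $(\mu^-)$ $\lambda \circ \mu^B A = A\mu^B \circ \lambda B \circ B\lambda$; it is a weak distributive law if it satisfies $(\eta^+)$, $(\mu^+)$, $(\mu^-)$. For a weak distributive law $\lambda \colon BA \Rightarrow AB$, the natural transformation $\kappa^\lambda \triangleq A\mu^B \circ \lambda B \circ \eta^B AB \colon AB \Rightarrow AB$ is idempotent; a splitting is a functor $K$ with $\pi^\lambda \colon AB \Rightarrow K$, $\iota^\lambda \colon K \Rightarrow AB$, $\iota^\lambda \circ \pi^\lambda = \kappa^\lambda$, $\pi^\lambda \circ \iota^\lambda = 1_K$; the weak composite monad is $A\bullet_\lambda B \triangleq (K,\ \pi^\lambda \circ \eta^A\eta^B,\ \pi^\lambda \circ \mu^A\mu^B \circ A\lambda B \circ \iota^\lambda\iota^\lambda)$. Under the stated hypotheses, $\phi$ is a weak distributive law of the monad $T$ over $R\bullet_\sigma S$ and $\psi$ is a weak distributive law of $S\bullet_\lambda T$ over $R$, so both weak composites are defined. -}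

module Defs where

open import Level using (Level; _⊔_; suc)
open import Data.Product using (Σ; _×_; _,_)
open import Relation.Binary using (IsEquivalence)

record Category (o ℓ e : Level) : Set (suc (o ⊔ ℓ ⊔ e)) where
  infix 4 _≈_
  infixr 9 _∘_
  field
    Obj : Set o
    Hom : Obj → Obj → Set ℓ
    _≈_ : ∀ {A B} → Hom A B → Hom A B → Set e
    ≈-equiv : ∀ {A B} → IsEquivalence (_≈_ {A} {B})
    id : ∀ {A} → Hom A A
    _∘_ : ∀ {A B C} → Hom B C → Hom A B → Hom A C
    assoc : ∀ {A B C D} {f : Hom A B} {g : Hom B C} {h : Hom C D} →
            (h ∘ g) ∘ f ≈ h ∘ (g ∘ f)
    identityˡ : ∀ {A B} {f : Hom A B} → id ∘ f ≈ f
    identityʳ : ∀ {A B} {f : Hom A B} → f ∘ id ≈ f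
    ∘-resp-≈ : ∀ {A B C} {f h : Hom B C} {g i : Hom A B} →
               f ≈ h → g ≈ i → f ∘ g ≈ h ∘ i

module _ {o ℓ e} (𝒞 : Category o ℓ e) where
  open Category 𝒞

  private
    module E {A B} = IsEquivalence (≈-equiv {A} {B})

  IdempotentComplete : Set (o ⊔ ℓ ⊔ e)
  IdempotentComplete = ∀ {A} (f : Hom A A) → f ∘ f ≈ f →
    Σ Obj λ B → Σ (Hom A B) λ r → Σ (Hom B A) λ s → (s ∘ r ≈ f) × (r ∘ s ≈ id)

  record Endofunctor : Set (o ⊔ ℓ ⊔ e) where
    field
      F₀ : Obj → Obj
      F₁ : ∀ {A B} → Hom A B → Hom (F₀ A) (F₀ B)
      identity : ∀ {A} → F₁ (id {A}) ≈ id
      homomorphism : ∀ {A B C} {f : Hom A B} {g : Hom B C} →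
                     F₁ (g ∘ f) ≈ F₁ g ∘ F₁ f
      F-resp-≈ : ∀ {A B} {f g : Hom A B} → f ≈ g → F₁ f ≈ F₁ g
  open Endofunctor public

  Idᶠ : Endofunctor
  Idᶠ = record
    { F₀ = λ X → X ; F₁ = λ f → f
    ; identity = E.refl ; homomorphism = E.refl ; F-resp-≈ = λ p → p }

  _∘ᶠ_ : Endofunctor → Endofunctor → Endofunctor
  F ∘ᶠ G = record
    { F₀ = λ X → F₀ F (F₀ G X)
    ; F₁ = λ f → F₁ F (F₁ G f)
    ; identity = E.trans (F-resp-≈ F (identity G)) (identity F)
    ; homomorphism = E.trans (F-resp-≈ F (homomorphism G)) (homomorphism F)
    ; F-resp-≈ = λ p → F-resp-≈ F (F-resp-≈ G p) }

  Fam : Endofunctor → Endofunctor → Set (o ⊔ ℓ)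
  Fam F G = ∀ X → Hom (F₀ F X) (F₀ G X)

  IsNatural : (F G : Endofunctor) → Fam F G → Set (o ⊔ ℓ ⊔ e)
  IsNatural F G α = ∀ {X Y} (f : Hom X Y) → α Y ∘ F₁ F f ≈ F₁ G f ∘ α X

  record MonadData : Set (o ⊔ ℓ ⊔ e) where
    field
      M : Endofunctor
      unit : Fam Idᶠ M
      mult : Fam (M ∘ᶠ M) M
  open MonadData public

  record IsMonad (T : MonadData) : Set (o ⊔ ℓ ⊔ e) where
    field
      unit-nat : IsNatural Idᶠ (M T) (unit T)
      mult-nat : IsNatural (M T ∘ᶠ M T) (M T) (mult T)
      mult-assoc : ∀ X → mult T X ∘ F₁ (M T) (mult T X) ≈ mult T X ∘ mult T (F₀ (M T) X)
      mult-unitˡ : ∀ X → mult T X ∘ F₁ (M T) (unit T X) ≈ id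
      mult-unitʳ : ∀ X → mult T X ∘ unit T (F₀ (M T) X) ≈ id

  module _ (A B : MonadData) (λ' : Fam (M B ∘ᶠ M A) (M A ∘ᶠ M B)) where
    private
      A₀ = F₀ (M A); A₁ = λ {X} {Y} → F₁ (M A) {X} {Y}
      B₀ = F₀ (M B); B₁ = λ {X} {Y} → F₁ (M B) {X} {Y}

    record IsWeakDistributiveLaw : Set (o ⊔ ℓ ⊔ e) where
      field
        natural : IsNatural (M B ∘ᶠ M A) (M A ∘ᶠ M B) λ'
        η⁺ : ∀ X → λ' X ∘ B₁ (unit A X) ≈ unit A (B₀ X)
        μ⁺ : ∀ X → λ' X ∘ B₁ (mult A X) ≈ mult A (B₀ X) ∘ (A₁ (λ' X) ∘ λ' (A₀ X))
        μ⁻ : ∀ X → λ' X ∘ mult B (A₀ X) ≈ A₁ (mult B X) ∘ (λ' (B₀ X) ∘ B₁ (λ' X))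

    record IsDistributiveLaw : Set (o ⊔ ℓ ⊔ e) where
      field
        weak : IsWeakDistributiveLaw
        η⁻ : ∀ X → λ' X ∘ unit B (A₀ X) ≈ A₁ (unit B X)

    κ : Fam (M A ∘ᶠ M B) (M A ∘ᶠ M B)
    κ X = A₁ (mult B X) ∘ (λ' (B₀ X) ∘ unit B (A₀ (B₀ X)))

  record Splitting (F : Endofunctor) (κ' : Fam F F) (K : Endofunctor) : Set (o ⊔ ℓ ⊔ e) where
    field
      π : Fam F K
      π-nat : IsNatural F K π
      ι : Fam K F
      ι-nat : IsNatural K F ι
      ι∘π : ∀ X → ι X ∘ π X ≈ κ' X
      π∘ι : ∀ X → π X ∘ ι X ≈ id
  open Splitting public

  weakComposite : (A B : MonadData) (λ' : Fam (M B ∘ᶠ M A) (M A ∘ᶠ M B))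
                  {K : Endofunctor} → Splitting (M A ∘ᶠ M B) (κ A B λ') K → MonadData
  weakComposite A B λ' {K} sp = record
    { M = K
    ; unit = λ X → π sp X ∘ (F₁ (M A) (unit B X) ∘ unit A X)
    ; mult = λ X → π sp X ∘ ((mult A (F₀ (M B) X) ∘ F₁ (M A) (F₁ (M A) (mult B X)))
                    ∘ (F₁ (M A) (λ' (F₀ (M B) X))
                    ∘ (ι sp (F₀ (M A) (F₀ (M B) X)) ∘ F₁ K (ι sp X))))
    }

module Submission where

-- Both weak composites are retracts of RST. Write a = κ^σ T and b = R κ^λ for the two
-- idempotents on RST. Conjugating by the given splittings turns κ^φ into aba and κ^ψ into bab.
-- The Yang–Baxter equation and (η⁻) for τ make ab the idempotent Rμ^{ST} ∘ Ψ ∘ η^{ST} of the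
-- composite Ψ = σT ∘ Sτ, so (ab)² = ab; therefore a splitting (K, p, j) of aba yields the
-- splitting (p ∘ Rι^λ, Rπ^λ ∘ j) of κ^ψ. Through p and j both multiplications become the same
-- multiplication of RST, the second one preceded by b; as the image of j is fixed by aba and
-- that multiplication commutes with a and b, (ab)² = ab absorbs the extra b.

open import Level using (_⊔_)
open import Data.Product using (Σ; _×_; _,_)
open import Relation.Binary using (IsEquivalence; Setoid)
import Relation.Binary.Reasoning.Setoid as SetoidReasoning
open import Defs

module CategoryReasoning {o ℓ e} (𝒞 : Category o ℓ e) where
  open Category 𝒞 public

  module Equiv {A B : Obj} = IsEquivalence (≈-equiv {A} {B})
  open Equiv public using (refl; sym; trans)

  hom-setoid : Obj → Obj → Setoid ℓ e
  hom-setoid A B = record { Carrier = Hom A B ; _≈_ = _≈_ ; isEquivalence = ≈-equiv }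

  module _ {A B : Obj} where
    open SetoidReasoning (hom-setoid A B) public

  infixr 4 _⟩∘⟨_ refl⟩∘⟨_
  infixl 5 _⟩∘⟨refl

  _⟩∘⟨_ : ∀ {A B C} {f h : Hom B C} {g i : Hom A B} → f ≈ h → g ≈ i → f ∘ g ≈ h ∘ i
  p ⟩∘⟨ q = ∘-resp-≈ p q

  refl⟩∘⟨_ : ∀ {A B C} {f : Hom B C} {g i : Hom A B} → g ≈ i → f ∘ g ≈ f ∘ i
  refl⟩∘⟨ q = ∘-resp-≈ refl q

  _⟩∘⟨refl : ∀ {A B C} {f h : Hom B C} {g : Hom A B} → f ≈ h → f ∘ g ≈ h ∘ g
  p ⟩∘⟨refl = ∘-resp-≈ p refl

  sym-assoc : ∀ {A B C D} {f : Hom A B} {g : Hom B C} {h : Hom C D} →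
              h ∘ (g ∘ f) ≈ (h ∘ g) ∘ f
  sym-assoc = sym assoc

  assoc³ : ∀ {A B C D E G} {f : Hom A B} {g : Hom B C} {h : Hom C D} {i : Hom D E} {j : Hom E G} →
           (j ∘ (i ∘ (h ∘ g))) ∘ f ≈ j ∘ (i ∘ (h ∘ (g ∘ f)))
  assoc³ = trans assoc (refl⟩∘⟨ trans assoc (refl⟩∘⟨ assoc))

  pullˡ : ∀ {A B C D} {a : Hom C D} {b : Hom B C} {c : Hom B D} →
          a ∘ b ≈ c → ∀ {f : Hom A B} → a ∘ (b ∘ f) ≈ c ∘ f
  pullˡ p = trans sym-assoc (p ⟩∘⟨refl)

  pullʳ : ∀ {A B C D} {b : Hom B C} {c : Hom A B} {d : Hom A C} →
          b ∘ c ≈ d → ∀ {a : Hom C D} → (a ∘ b) ∘ c ≈ a ∘ d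
  pullʳ p = trans assoc (refl⟩∘⟨ p)

  pull₃ˡ : ∀ {A B C D E} {a : Hom D E} {b : Hom C D} {c : Hom B C} {d : Hom B E} →
           a ∘ (b ∘ c) ≈ d → ∀ {f : Hom A B} → a ∘ (b ∘ (c ∘ f)) ≈ d ∘ f
  pull₃ˡ p = trans (refl⟩∘⟨ sym-assoc) (pullˡ p)

  extendʳ : ∀ {A B B′ C D} {a : Hom C D} {b : Hom B C} {c : Hom B′ D} {d : Hom B B′} →
            a ∘ b ≈ c ∘ d → ∀ {f : Hom A B} → a ∘ (b ∘ f) ≈ c ∘ (d ∘ f)
  extendʳ p = trans sym-assoc (trans (p ⟩∘⟨refl) assoc)

  elimˡ : ∀ {A B} {a : Hom B B} {f : Hom A B} → a ≈ id → a ∘ f ≈ f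
  elimˡ p = trans (p ⟩∘⟨refl) identityˡ

  elimʳ : ∀ {A B} {a : Hom A A} {f : Hom A B} → a ≈ id → f ∘ a ≈ f
  elimʳ p = trans (refl⟩∘⟨ p) identityʳ

  cancelˡ : ∀ {A B C} {a : Hom B C} {b : Hom C B} {f : Hom A C} → a ∘ b ≈ id → a ∘ (b ∘ f) ≈ f
  cancelˡ p = trans (pullˡ p) identityˡ

  module FunctorReasoning (F : Endofunctor 𝒞) where
    resp-≈ : ∀ {A B} {f g : Hom A B} → f ≈ g → F₁ F f ≈ F₁ F g
    resp-≈ = F-resp-≈ F

    resp-∘ : ∀ {A B C} {f : Hom A B} {g : Hom B C} → F₁ F g ∘ F₁ F f ≈ F₁ F (g ∘ f)
    resp-∘ = sym (homomorphism F)

    resp-∘˘ : ∀ {A B C} {f : Hom A B} {g : Hom B C} → F₁ F (g ∘ f) ≈ F₁ F g ∘ F₁ F f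
    resp-∘˘ = homomorphism F

    resp-triangle : ∀ {A B C} {f : Hom A B} {g : Hom B C} {h : Hom A C} →
                    g ∘ f ≈ h → F₁ F g ∘ F₁ F f ≈ F₁ F h
    resp-triangle p = trans resp-∘ (resp-≈ p)

    resp-square : ∀ {A B B′ C} {f : Hom A B} {g : Hom B C} {h : Hom A B′} {k : Hom B′ C} →
                  g ∘ f ≈ k ∘ h → F₁ F g ∘ F₁ F f ≈ F₁ F k ∘ F₁ F h
    resp-square p = trans (resp-triangle p) resp-∘˘

    resp-retract : ∀ {A B} {f : Hom A B} {g : Hom B A} → g ∘ f ≈ id → F₁ F g ∘ F₁ F f ≈ id
    resp-retract p = trans (resp-triangle p) (identity F)

    resp-∘₃ : ∀ {A B C D} {f : Hom C D} {g : Hom B C} {h : Hom A B} →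
              F₁ F f ∘ (F₁ F g ∘ F₁ F h) ≈ F₁ F (f ∘ (g ∘ h))
    resp-∘₃ = trans (refl⟩∘⟨ resp-∘) resp-∘

    resp-∘₄ : ∀ {A B C D E} {f : Hom D E} {g : Hom C D} {h : Hom B C} {i : Hom A B} →
              F₁ F f ∘ (F₁ F g ∘ (F₁ F h ∘ F₁ F i)) ≈ F₁ F (f ∘ (g ∘ (h ∘ i)))
    resp-∘₄ = trans (refl⟩∘⟨ resp-∘₃) resp-∘

    resp-∘₅ : ∀ {A B C D E G} {f : Hom E G} {g : Hom D E} {h : Hom C D} {i : Hom B C} {j : Hom A B} →
              F₁ F f ∘ (F₁ F g ∘ (F₁ F h ∘ (F₁ F i ∘ F₁ F j))) ≈ F₁ F (f ∘ (g ∘ (h ∘ (i ∘ j))))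
    resp-∘₅ = trans (refl⟩∘⟨ resp-∘₄) resp-∘

    resp-∘₆ : ∀ {A B C D E G H} {f : Hom G H} {g : Hom E G} {h : Hom D E} {i : Hom C D} {j : Hom B C}
                {k : Hom A B} →
              F₁ F f ∘ (F₁ F g ∘ (F₁ F h ∘ (F₁ F i ∘ (F₁ F j ∘ F₁ F k))))
                ≈ F₁ F (f ∘ (g ∘ (h ∘ (i ∘ (j ∘ k)))))
    resp-∘₆ = trans (refl⟩∘⟨ resp-∘₅) resp-∘

module NaturalityAndSplittings {o ℓ e} (𝒞 : Category o ℓ e) where
  open CategoryReasoning 𝒞

  -- The functors are explicit arguments: IsNatural unfolds, so they cannot be inferred.
  natural-∘ : ∀ F G H {β : Fam 𝒞 G H} {α : Fam 𝒞 F G} →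
              IsNatural 𝒞 G H β → IsNatural 𝒞 F G α → IsNatural 𝒞 F H (λ X → β X ∘ α X)
  natural-∘ F G H {β} {α} β-nat α-nat f = begin
    (β _ ∘ α _) ∘ F₁ F f ≈⟨ pullʳ (α-nat f) ⟩
    β _ ∘ (F₁ G f ∘ α _) ≈⟨ pullˡ (β-nat f) ⟩
    (F₁ H f ∘ β _) ∘ α _ ≈⟨ assoc ⟩
    F₁ H f ∘ (β _ ∘ α _) ∎

  natural-whiskerˡ : ∀ F G H {α : Fam 𝒞 F G} →
                     IsNatural 𝒞 F G α → IsNatural 𝒞 (_∘ᶠ_ 𝒞 H F) (_∘ᶠ_ 𝒞 H G) (λ X → F₁ H (α X))
  natural-whiskerˡ F G H α-nat f = FunctorReasoning.resp-square H (α-nat f)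

  natural-whiskerʳ : ∀ F G H {α : Fam 𝒞 F G} →
                     IsNatural 𝒞 F G α → IsNatural 𝒞 (_∘ᶠ_ 𝒞 F H) (_∘ᶠ_ 𝒞 G H) (λ X → α (F₀ H X))
  natural-whiskerʳ F G H α-nat f = α-nat (F₁ H f)

  module _ {F K : Endofunctor 𝒞} {κ′ : Fam 𝒞 F F} (sp : Splitting 𝒞 F κ′ K) where

    splitting-idempotent : ∀ X → κ′ X ∘ κ′ X ≈ κ′ X
    splitting-idempotent X = begin
      κ′ X ∘ κ′ X                           ≈⟨ ι∘π sp X ⟩∘⟨ ι∘π sp X ⟨
      (ι sp X ∘ π sp X) ∘ (ι sp X ∘ π sp X) ≈⟨ pullʳ (cancelˡ (π∘ι sp X)) ⟩
      ι sp X ∘ π sp X                       ≈⟨ ι∘π sp X ⟩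
      κ′ X                                  ∎

    π∘κ≈π : ∀ X → π sp X ∘ κ′ X ≈ π sp X
    π∘κ≈π X = begin
      π sp X ∘ κ′ X             ≈⟨ refl⟩∘⟨ ι∘π sp X ⟨
      π sp X ∘ (ι sp X ∘ π sp X) ≈⟨ cancelˡ (π∘ι sp X) ⟩
      π sp X                     ∎

    κ∘ι≈ι : ∀ X → κ′ X ∘ ι sp X ≈ ι sp X
    κ∘ι≈ι X = begin
      κ′ X ∘ ι sp X              ≈⟨ ι∘π sp X ⟩∘⟨refl ⟨
      (ι sp X ∘ π sp X) ∘ ι sp X ≈⟨ pullʳ (π∘ι sp X) ⟩
      ι sp X ∘ id                ≈⟨ identityʳ ⟩
      ι sp X                     ∎

module WeakDistributiveLaw {o ℓ e} (𝒞 : Category o ℓ e) {A B : MonadData 𝒞}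
         (A-monad : IsMonad 𝒞 A) (B-monad : IsMonad 𝒞 B)
         {δ : Fam 𝒞 (_∘ᶠ_ 𝒞 (M B) (M A)) (_∘ᶠ_ 𝒞 (M A) (M B))}
         (weak : IsWeakDistributiveLaw 𝒞 A B δ) where
  open CategoryReasoning 𝒞
  open NaturalityAndSplittings 𝒞 using (splitting-idempotent)
  private
    module FA = FunctorReasoning (M A)
    module FAB = FunctorReasoning (_∘ᶠ_ 𝒞 (M A) (M B))
    module mA = IsMonad A-monad
    module mB = IsMonad B-monad
    module δ = IsWeakDistributiveLaw weak

    A₀ B₀ : Obj → Obj
    A₀ = F₀ (M A)
    B₀ = F₀ (M B)
    A₁ : ∀ {X Y} → Hom X Y → Hom (A₀ X) (A₀ Y)
    A₁ = F₁ (M A)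
    B₁ : ∀ {X Y} → Hom X Y → Hom (B₀ X) (B₀ Y)
    B₁ = F₁ (M B)
    ηA : Fam 𝒞 (Idᶠ 𝒞) (M A)
    ηA = unit A
    ηB : Fam 𝒞 (Idᶠ 𝒞) (M B)
    ηB = unit B
    μA : Fam 𝒞 (_∘ᶠ_ 𝒞 (M A) (M A)) (M A)
    μA = mult A
    μB : Fam 𝒞 (_∘ᶠ_ 𝒞 (M B) (M B)) (M B)
    μB = mult B

  ηᴬᴮ : ∀ X → Hom X (A₀ (B₀ X))
  ηᴬᴮ X = A₁ (ηB X) ∘ ηA X

  μᴬᴮ : ∀ X → Hom (A₀ (B₀ (A₀ (B₀ X)))) (A₀ (B₀ X))
  μᴬᴮ X = μA (B₀ X) ∘ (A₁ (A₁ (μB X)) ∘ A₁ (δ (B₀ X)))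

  κᵟ : ∀ X → Hom (A₀ (B₀ X)) (A₀ (B₀ X))
  κᵟ = κ 𝒞 A B δ

  ηᴬᴮ-natural : ∀ {X Y} (f : Hom X Y) → ηᴬᴮ Y ∘ f ≈ A₁ (B₁ f) ∘ ηᴬᴮ X
  ηᴬᴮ-natural f = begin
    (A₁ (ηB _) ∘ ηA _) ∘ f         ≈⟨ pullʳ (mA.unit-nat f) ⟩
    A₁ (ηB _) ∘ (A₁ f ∘ ηA _)      ≈⟨ pullˡ (FA.resp-square (mB.unit-nat f)) ⟩
    (A₁ (B₁ f) ∘ A₁ (ηB _)) ∘ ηA _ ≈⟨ assoc ⟩
    A₁ (B₁ f) ∘ ηᴬᴮ _              ∎

  μᴬᴮ-natural : ∀ {X Y} (f : Hom X Y) → μᴬᴮ Y ∘ A₁ (B₁ (A₁ (B₁ f))) ≈ A₁ (B₁ f) ∘ μᴬᴮ X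
  μᴬᴮ-natural f = begin
    (μA _ ∘ (A₁ (A₁ (μB _)) ∘ A₁ (δ _))) ∘ A₁ (B₁ (A₁ (B₁ f)))
      ≈⟨ pullʳ (pullʳ (FA.resp-square (δ.natural (B₁ f)))) ⟩
    μA _ ∘ (A₁ (A₁ (μB _)) ∘ (A₁ (A₁ (B₁ (B₁ f))) ∘ A₁ (δ _)))
      ≈⟨ refl⟩∘⟨ pullˡ (FA.resp-square (FA.resp-square (mB.mult-nat f))) ⟩
    μA _ ∘ ((A₁ (A₁ (B₁ f)) ∘ A₁ (A₁ (μB _))) ∘ A₁ (δ _))
      ≈⟨ refl⟩∘⟨ assoc ⟩
    μA _ ∘ (A₁ (A₁ (B₁ f)) ∘ (A₁ (A₁ (μB _)) ∘ A₁ (δ _)))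
      ≈⟨ pullˡ (mA.mult-nat (B₁ f)) ⟩
    (A₁ (B₁ f) ∘ μA _) ∘ (A₁ (A₁ (μB _)) ∘ A₁ (δ _))
      ≈⟨ assoc ⟩
    A₁ (B₁ f) ∘ μᴬᴮ _ ∎

  μᴬᴮ-unitˡ : ∀ X → μᴬᴮ X ∘ A₁ (B₁ (ηᴬᴮ X)) ≈ id
  μᴬᴮ-unitˡ X = begin
    (μA _ ∘ (A₁ (A₁ (μB X)) ∘ A₁ (δ (B₀ X)))) ∘ A₁ (B₁ (ηᴬᴮ X))
      ≈⟨ pullʳ (pullʳ FA.resp-∘) ⟩
    μA _ ∘ (A₁ (A₁ (μB X)) ∘ A₁ (δ (B₀ X) ∘ B₁ (ηᴬᴮ X)))
      ≈⟨ refl⟩∘⟨ FA.resp-triangle δ-after-ηᴬᴮ ⟩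
    μA _ ∘ A₁ (ηA (B₀ X))
      ≈⟨ mA.mult-unitˡ _ ⟩
    id ∎
    where
    δ-after-ηᴬᴮ : A₁ (μB X) ∘ (δ (B₀ X) ∘ B₁ (ηᴬᴮ X)) ≈ ηA (B₀ X)
    δ-after-ηᴬᴮ = begin
      A₁ (μB X) ∘ (δ (B₀ X) ∘ B₁ (A₁ (ηB X) ∘ ηA X))
        ≈⟨ refl⟩∘⟨ refl⟩∘⟨ homomorphism (M B) ⟩
      A₁ (μB X) ∘ (δ (B₀ X) ∘ (B₁ (A₁ (ηB X)) ∘ B₁ (ηA X)))
        ≈⟨ refl⟩∘⟨ extendʳ (δ.natural (ηB X)) ⟩
      A₁ (μB X) ∘ (A₁ (B₁ (ηB X)) ∘ (δ X ∘ B₁ (ηA X)))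
        ≈⟨ cancelˡ (FA.resp-retract (mB.mult-unitˡ X)) ⟩
      δ X ∘ B₁ (ηA X)
        ≈⟨ δ.η⁺ X ⟩
      ηA (B₀ X) ∎

  μᴬᴮ-unitʳ : ∀ X → μᴬᴮ X ∘ ηᴬᴮ (A₀ (B₀ X)) ≈ κᵟ X
  μᴬᴮ-unitʳ X = begin
    (μA _ ∘ (A₁ (A₁ (μB X)) ∘ A₁ (δ (B₀ X)))) ∘ (A₁ (ηB _) ∘ ηA _)
      ≈⟨ pullʳ (pullʳ (pullˡ FA.resp-∘)) ⟩
    μA _ ∘ (A₁ (A₁ (μB X)) ∘ (A₁ (δ (B₀ X) ∘ ηB _) ∘ ηA _))
      ≈⟨ refl⟩∘⟨ pullˡ FA.resp-∘ ⟩
    μA _ ∘ (A₁ (κᵟ X) ∘ ηA _)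
      ≈⟨ refl⟩∘⟨ mA.unit-nat (κᵟ X) ⟨
    μA _ ∘ (ηA _ ∘ κᵟ X)
      ≈⟨ cancelˡ (mA.mult-unitʳ _) ⟩
    κᵟ X ∎

  κ-fixes-ηᴬᴮ : ∀ X → κᵟ X ∘ ηᴬᴮ X ≈ ηᴬᴮ X
  κ-fixes-ηᴬᴮ X = begin
    (A₁ (μB X) ∘ (δ (B₀ X) ∘ ηB (A₀ (B₀ X)))) ∘ (A₁ (ηB X) ∘ ηA X)
      ≈⟨ pullʳ (pullʳ (extendʳ (mB.unit-nat (A₁ (ηB X))))) ⟩
    A₁ (μB X) ∘ (δ (B₀ X) ∘ (B₁ (A₁ (ηB X)) ∘ (ηB (A₀ X) ∘ ηA X)))
      ≈⟨ refl⟩∘⟨ extendʳ (δ.natural (ηB X)) ⟩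
    A₁ (μB X) ∘ (A₁ (B₁ (ηB X)) ∘ (δ X ∘ (ηB (A₀ X) ∘ ηA X)))
      ≈⟨ cancelˡ (FA.resp-retract (mB.mult-unitˡ X)) ⟩
    δ X ∘ (ηB (A₀ X) ∘ ηA X)
      ≈⟨ refl⟩∘⟨ mB.unit-nat (ηA X) ⟩
    δ X ∘ (B₁ (ηA X) ∘ ηB X)
      ≈⟨ pullˡ (δ.η⁺ X) ⟩
    ηA (B₀ X) ∘ ηB X
      ≈⟨ mA.unit-nat (ηB X) ⟩
    ηᴬᴮ X ∎

  μᴬᴮ-assoc : ∀ X → μᴬᴮ X ∘ μᴬᴮ (A₀ (B₀ X)) ≈ μᴬᴮ X ∘ A₁ (B₁ (μᴬᴮ X))
  μᴬᴮ-assoc X = begin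
    μᴬᴮ X ∘ μᴬᴮ (A₀ (B₀ X))
      ≈⟨ trans assoc (refl⟩∘⟨ assoc) ⟩
    μA (B₀ X) ∘ (A₁ (A₁ (μB X)) ∘ (A₁ (δ (B₀ X)) ∘ (μA _ ∘ (A₁ (A₁ (μB (A₀ (B₀ X)))) ∘ A₁ (δ (B₀ (A₀ (B₀ X))))))))
      ≈⟨ refl⟩∘⟨ refl⟩∘⟨ extendʳ (mA.mult-nat (δ (B₀ X))) ⟨
    μA (B₀ X) ∘ (A₁ (A₁ (μB X)) ∘ (μA _ ∘ (A₁ (A₁ (δ (B₀ X))) ∘ (A₁ (A₁ (μB (A₀ (B₀ X)))) ∘ A₁ (δ (B₀ (A₀ (B₀ X))))))))
      ≈⟨ refl⟩∘⟨ extendʳ (mA.mult-nat (A₁ (μB X))) ⟨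
    μA (B₀ X) ∘ (μA _ ∘ (A₁ (A₁ (A₁ (μB X))) ∘ (A₁ (A₁ (δ (B₀ X))) ∘ (A₁ (A₁ (μB (A₀ (B₀ X)))) ∘ A₁ (δ (B₀ (A₀ (B₀ X))))))))
      ≈⟨ extendʳ (mA.mult-assoc _) ⟨
    μA (B₀ X) ∘ (A₁ (μA _) ∘ (A₁ (A₁ (A₁ (μB X))) ∘ (A₁ (A₁ (δ (B₀ X))) ∘ (A₁ (A₁ (μB (A₀ (B₀ X)))) ∘ A₁ (δ (B₀ (A₀ (B₀ X))))))))
      ≈⟨ refl⟩∘⟨ FA.resp-∘₅ ⟩
    μA (B₀ X) ∘ A₁ (μA _ ∘ (A₁ (A₁ (μB X)) ∘ (A₁ (δ (B₀ X)) ∘ (A₁ (μB (A₀ (B₀ X))) ∘ δ (B₀ (A₀ (B₀ X)))))))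
      ≈⟨ refl⟩∘⟨ FA.resp-≈ (trans via-μ⁻ (sym via-μ-assoc)) ⟩
    μA (B₀ X) ∘ A₁ (μA _ ∘ (A₁ (A₁ (μB X)) ∘ (A₁ (δ (B₀ X)) ∘ (δ (A₀ (B₀ X)) ∘ (B₁ (A₁ (A₁ (μB X))) ∘ B₁ (A₁ (δ (B₀ X))))))))
      ≈⟨ refl⟩∘⟨ FA.resp-∘₆ ⟨
    μA (B₀ X) ∘ (A₁ (μA (B₀ X)) ∘ (A₁ (A₁ (A₁ (μB X))) ∘ (A₁ (A₁ (δ (B₀ X))) ∘ (A₁ (δ (A₀ (B₀ X))) ∘ (A₁ (B₁ (A₁ (A₁ (μB X)))) ∘ A₁ (B₁ (A₁ (δ (B₀ X)))))))))
      ≈⟨ refl⟩∘⟨ extendʳ (FA.resp-square (sym (mA.mult-nat (μB X)))) ⟨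
    μA (B₀ X) ∘ (A₁ (A₁ (μB X)) ∘ (A₁ (μA (B₀ (B₀ X))) ∘ (A₁ (A₁ (δ (B₀ X))) ∘ (A₁ (δ (A₀ (B₀ X))) ∘ (A₁ (B₁ (A₁ (A₁ (μB X)))) ∘ A₁ (B₁ (A₁ (δ (B₀ X)))))))))
      ≈⟨ refl⟩∘⟨ refl⟩∘⟨ pull₃ˡ (trans FA.resp-∘₃ (FA.resp-≈ (sym (δ.μ⁺ (B₀ X))))) ⟩
    μA (B₀ X) ∘ (A₁ (A₁ (μB X)) ∘ (A₁ (δ (B₀ X) ∘ B₁ (μA (B₀ X))) ∘ (A₁ (B₁ (A₁ (A₁ (μB X)))) ∘ A₁ (B₁ (A₁ (δ (B₀ X)))))))
      ≈⟨ refl⟩∘⟨ refl⟩∘⟨ trans (FA.resp-∘˘ ⟩∘⟨ FAB.resp-∘) (pullʳ FAB.resp-∘) ⟩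
    μA (B₀ X) ∘ (A₁ (A₁ (μB X)) ∘ (A₁ (δ (B₀ X)) ∘ A₁ (B₁ (μᴬᴮ X))))
      ≈⟨ trans (refl⟩∘⟨ sym-assoc) sym-assoc ⟩
    μᴬᴮ X ∘ A₁ (B₁ (μᴬᴮ X)) ∎
    where
    core : Hom (B₀ (A₀ (B₀ (A₀ (B₀ X))))) (A₀ (B₀ X))
    core = μA (B₀ X) ∘ (A₁ (A₁ (μB X)) ∘ (A₁ (A₁ (μB (B₀ X))) ∘ (A₁ (δ (B₀ (B₀ X))) ∘ (δ (A₀ (B₀ (B₀ X))) ∘ B₁ (A₁ (δ (B₀ X)))))))

    via-μ⁻ : μA _ ∘ (A₁ (A₁ (μB X)) ∘ (A₁ (δ (B₀ X)) ∘ (A₁ (μB (A₀ (B₀ X))) ∘ δ (B₀ (A₀ (B₀ X)))))) ≈ core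
    via-μ⁻ = begin
      μA _ ∘ (A₁ (A₁ (μB X)) ∘ (A₁ (δ (B₀ X)) ∘ (A₁ (μB (A₀ (B₀ X))) ∘ δ (B₀ (A₀ (B₀ X))))))
        ≈⟨ refl⟩∘⟨ refl⟩∘⟨ pullˡ (FA.resp-triangle (δ.μ⁻ (B₀ X))) ⟩
      μA _ ∘ (A₁ (A₁ (μB X)) ∘ (A₁ (A₁ (μB (B₀ X)) ∘ (δ (B₀ (B₀ X)) ∘ B₁ (δ (B₀ X)))) ∘ δ (B₀ (A₀ (B₀ X)))))
        ≈⟨ refl⟩∘⟨ refl⟩∘⟨ trans (FA.resp-∘˘ ⟩∘⟨refl) (pullʳ (FA.resp-∘˘ ⟩∘⟨refl)) ⟩
      μA _ ∘ (A₁ (A₁ (μB X)) ∘ (A₁ (A₁ (μB (B₀ X))) ∘ ((A₁ (δ (B₀ (B₀ X))) ∘ A₁ (B₁ (δ (B₀ X)))) ∘ δ (B₀ (A₀ (B₀ X))))))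
        ≈⟨ refl⟩∘⟨ refl⟩∘⟨ refl⟩∘⟨ pullʳ (sym (δ.natural (δ (B₀ X)))) ⟩
      core ∎

    via-μ-assoc : μA _ ∘ (A₁ (A₁ (μB X)) ∘ (A₁ (δ (B₀ X)) ∘ (δ (A₀ (B₀ X)) ∘ (B₁ (A₁ (A₁ (μB X))) ∘ B₁ (A₁ (δ (B₀ X))))))) ≈ core
    via-μ-assoc = begin
      μA _ ∘ (A₁ (A₁ (μB X)) ∘ (A₁ (δ (B₀ X)) ∘ (δ (A₀ (B₀ X)) ∘ (B₁ (A₁ (A₁ (μB X))) ∘ B₁ (A₁ (δ (B₀ X)))))))
        ≈⟨ refl⟩∘⟨ refl⟩∘⟨ refl⟩∘⟨ extendʳ (δ.natural (A₁ (μB X))) ⟩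
      μA _ ∘ (A₁ (A₁ (μB X)) ∘ (A₁ (δ (B₀ X)) ∘ (A₁ (B₁ (A₁ (μB X))) ∘ (δ (A₀ (B₀ (B₀ X))) ∘ B₁ (A₁ (δ (B₀ X)))))))
        ≈⟨ refl⟩∘⟨ refl⟩∘⟨ trans (pullˡ (FA.resp-square (δ.natural (μB X)))) assoc ⟩
      μA _ ∘ (A₁ (A₁ (μB X)) ∘ (A₁ (A₁ (B₁ (μB X))) ∘ (A₁ (δ (B₀ (B₀ X))) ∘ (δ (A₀ (B₀ (B₀ X))) ∘ B₁ (A₁ (δ (B₀ X)))))))
        ≈⟨ refl⟩∘⟨ extendʳ (FA.resp-square (FA.resp-square (mB.mult-assoc X))) ⟩
      core ∎

  μᴬᴮ-absorbs-κ : ∀ X → μᴬᴮ X ∘ A₁ (B₁ (κᵟ X)) ≈ μᴬᴮ X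
  μᴬᴮ-absorbs-κ X = begin
    μᴬᴮ X ∘ A₁ (B₁ (κᵟ X))                               ≈⟨ refl⟩∘⟨ FAB.resp-≈ (μᴬᴮ-unitʳ X) ⟨
    μᴬᴮ X ∘ A₁ (B₁ (μᴬᴮ X ∘ ηᴬᴮ (A₀ (B₀ X))))              ≈⟨ refl⟩∘⟨ FAB.resp-∘˘ ⟩
    μᴬᴮ X ∘ (A₁ (B₁ (μᴬᴮ X)) ∘ A₁ (B₁ (ηᴬᴮ (A₀ (B₀ X))))) ≈⟨ extendʳ (μᴬᴮ-assoc X) ⟨
    μᴬᴮ X ∘ (μᴬᴮ (A₀ (B₀ X)) ∘ A₁ (B₁ (ηᴬᴮ (A₀ (B₀ X))))) ≈⟨ elimʳ (μᴬᴮ-unitˡ _) ⟩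
    μᴬᴮ X                                                ∎

  μᴬᴮ-κ-commute : ∀ X → μᴬᴮ X ∘ κᵟ (A₀ (B₀ X)) ≈ κᵟ X ∘ μᴬᴮ X
  μᴬᴮ-κ-commute X = begin
    μᴬᴮ X ∘ κᵟ (A₀ (B₀ X))                 ≈⟨ refl⟩∘⟨ μᴬᴮ-unitʳ _ ⟨
    μᴬᴮ X ∘ (μᴬᴮ (A₀ (B₀ X)) ∘ ηᴬᴮ _)      ≈⟨ pullˡ (μᴬᴮ-assoc X) ⟩
    (μᴬᴮ X ∘ A₁ (B₁ (μᴬᴮ X))) ∘ ηᴬᴮ _      ≈⟨ assoc ⟩
    μᴬᴮ X ∘ (A₁ (B₁ (μᴬᴮ X)) ∘ ηᴬᴮ _)      ≈⟨ refl⟩∘⟨ ηᴬᴮ-natural (μᴬᴮ X) ⟨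
    μᴬᴮ X ∘ (ηᴬᴮ _ ∘ μᴬᴮ X)                ≈⟨ pullˡ (μᴬᴮ-unitʳ X) ⟩
    κᵟ X ∘ μᴬᴮ X                           ∎

  module WeakComposite {K : Endofunctor 𝒞} (sp : Splitting 𝒞 (_∘ᶠ_ 𝒞 (M A) (M B)) κᵟ K) where
    private
      W : MonadData 𝒞
      W = weakComposite 𝒞 A B δ sp

    ι∘unit≈ηᴬᴮ : ∀ X → ι sp X ∘ unit W X ≈ ηᴬᴮ X
    ι∘unit≈ηᴬᴮ X = trans (pullˡ (ι∘π sp X)) (κ-fixes-ηᴬᴮ X)

    ι∘mult∘π≈κ∘μᴬᴮ : ∀ X → (ι sp X ∘ mult W X) ∘ π sp (F₀ K X) ≈ κᵟ X ∘ (μᴬᴮ X ∘ A₁ (B₁ (ι sp X)))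
    ι∘mult∘π≈κ∘μᴬᴮ X = begin
      (ι sp X ∘ (π sp X ∘ ((μA (B₀ X) ∘ A₁ (A₁ (μB X))) ∘ (A₁ (δ (B₀ X)) ∘ (ι sp (A₀ (B₀ X)) ∘ F₁ K (ι sp X))))))
        ∘ π sp (F₀ K X)
        ≈⟨ pullˡ (ι∘π sp X) ⟩∘⟨refl ⟩
      (κᵟ X ∘ ((μA (B₀ X) ∘ A₁ (A₁ (μB X))) ∘ (A₁ (δ (B₀ X)) ∘ (ι sp (A₀ (B₀ X)) ∘ F₁ K (ι sp X)))))
        ∘ π sp (F₀ K X)
        ≈⟨ (refl⟩∘⟨ trans assoc (trans (refl⟩∘⟨ sym-assoc) sym-assoc)) ⟩∘⟨refl ⟩
      (κᵟ X ∘ (μᴬᴮ X ∘ (ι sp (A₀ (B₀ X)) ∘ F₁ K (ι sp X)))) ∘ π sp (F₀ K X)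
        ≈⟨ assoc³ ⟩
      κᵟ X ∘ (μᴬᴮ X ∘ (ι sp (A₀ (B₀ X)) ∘ (F₁ K (ι sp X) ∘ π sp (F₀ K X))))
        ≈⟨ refl⟩∘⟨ refl⟩∘⟨ refl⟩∘⟨ π-nat sp (ι sp X) ⟨
      κᵟ X ∘ (μᴬᴮ X ∘ (ι sp (A₀ (B₀ X)) ∘ (π sp (A₀ (B₀ X)) ∘ A₁ (B₁ (ι sp X)))))
        ≈⟨ refl⟩∘⟨ refl⟩∘⟨ pullˡ (ι∘π sp _) ⟩
      κᵟ X ∘ (μᴬᴮ X ∘ (κᵟ (A₀ (B₀ X)) ∘ A₁ (B₁ (ι sp X))))
        ≈⟨ refl⟩∘⟨ trans (pullˡ (μᴬᴮ-κ-commute X)) assoc ⟩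
      κᵟ X ∘ (κᵟ X ∘ (μᴬᴮ X ∘ A₁ (B₁ (ι sp X))))
        ≈⟨ pullˡ (splitting-idempotent sp X) ⟩
      κᵟ X ∘ (μᴬᴮ X ∘ A₁ (B₁ (ι sp X))) ∎

YangBaxter : ∀ {o ℓ e} (𝒞 : Category o ℓ e) (R S T : MonadData 𝒞) →
             Fam 𝒞 (_∘ᶠ_ 𝒞 (M T) (M S)) (_∘ᶠ_ 𝒞 (M S) (M T)) →
             Fam 𝒞 (_∘ᶠ_ 𝒞 (M S) (M R)) (_∘ᶠ_ 𝒞 (M R) (M S)) →
             Fam 𝒞 (_∘ᶠ_ 𝒞 (M T) (M R)) (_∘ᶠ_ 𝒞 (M R) (M T)) → Set (o ⊔ e)
YangBaxter 𝒞 R S T λ′ σ τ = ∀ X →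
  σ (F₀ (M T) X) ∘ (F₁ (M S) (τ X) ∘ λ′ (F₀ (M R) X))
    ≈ F₁ (M R) (λ′ X) ∘ (τ (F₀ (M S) X) ∘ F₁ (M T) (σ X))
  where open Category 𝒞

module YangBaxterComposites {o ℓ e} (𝒞 : Category o ℓ e) {R S T : MonadData 𝒞}
    (R-monad : IsMonad 𝒞 R) (S-monad : IsMonad 𝒞 S) (T-monad : IsMonad 𝒞 T)
    {λ′ : Fam 𝒞 (_∘ᶠ_ 𝒞 (M T) (M S)) (_∘ᶠ_ 𝒞 (M S) (M T))}
    {σ : Fam 𝒞 (_∘ᶠ_ 𝒞 (M S) (M R)) (_∘ᶠ_ 𝒞 (M R) (M S))}
    {τ : Fam 𝒞 (_∘ᶠ_ 𝒞 (M T) (M R)) (_∘ᶠ_ 𝒞 (M R) (M T))}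
    (wλ : IsWeakDistributiveLaw 𝒞 S T λ′) (wσ : IsWeakDistributiveLaw 𝒞 R S σ)
    (dτ : IsDistributiveLaw 𝒞 R T τ) (yang-baxter : YangBaxter 𝒞 R S T λ′ σ τ)
    {K₁ : Endofunctor 𝒞} (spσ : Splitting 𝒞 (_∘ᶠ_ 𝒞 (M R) (M S)) (κ 𝒞 R S σ) K₁)
    {K₂ : Endofunctor 𝒞} (spλ : Splitting 𝒞 (_∘ᶠ_ 𝒞 (M S) (M T)) (κ 𝒞 S T λ′) K₂) where
  open CategoryReasoning 𝒞
  open NaturalityAndSplittings 𝒞
  module FR = FunctorReasoning (M R)
  module FS = FunctorReasoning (M S)
  module FT = FunctorReasoning (M T)
  module FST = FunctorReasoning (_∘ᶠ_ 𝒞 (M S) (M T))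
  module FSS = FunctorReasoning (_∘ᶠ_ 𝒞 (M S) (M S))
  module FRR = FunctorReasoning (_∘ᶠ_ 𝒞 (M R) (M R))
  module FRS = FunctorReasoning (_∘ᶠ_ 𝒞 (M R) (M S))
  module mR = IsMonad R-monad
  module mS = IsMonad S-monad
  module mT = IsMonad T-monad
  module wλ = IsWeakDistributiveLaw wλ
  module wσ = IsWeakDistributiveLaw wσ
  module dτ = IsDistributiveLaw dτ
  module wτ = IsWeakDistributiveLaw dτ.weak
  module Wλ = WeakDistributiveLaw 𝒞 S-monad T-monad wλ
  module Wσ = WeakDistributiveLaw 𝒞 R-monad S-monad wσ

  R₀ S₀ T₀ RST₀ : Obj → Obj
  R₀ = F₀ (M R)
  S₀ = F₀ (M S)
  T₀ = F₀ (M T)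
  RST₀ X = R₀ (S₀ (T₀ X))
  R₁ : ∀ {X Y} → Hom X Y → Hom (R₀ X) (R₀ Y)
  R₁ = F₁ (M R)
  S₁ : ∀ {X Y} → Hom X Y → Hom (S₀ X) (S₀ Y)
  S₁ = F₁ (M S)
  T₁ : ∀ {X Y} → Hom X Y → Hom (T₀ X) (T₀ Y)
  T₁ = F₁ (M T)
  ηR : Fam 𝒞 (Idᶠ 𝒞) (M R)
  ηR = unit R
  ηS : Fam 𝒞 (Idᶠ 𝒞) (M S)
  ηS = unit S
  ηT : Fam 𝒞 (Idᶠ 𝒞) (M T)
  ηT = unit T
  μR : Fam 𝒞 (_∘ᶠ_ 𝒞 (M R) (M R)) (M R)
  μR = mult R
  μS : Fam 𝒞 (_∘ᶠ_ 𝒞 (M S) (M S)) (M S)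
  μS = mult S
  μT : Fam 𝒞 (_∘ᶠ_ 𝒞 (M T) (M T)) (M T)
  μT = mult T
  πσ : Fam 𝒞 (_∘ᶠ_ 𝒞 (M R) (M S)) K₁
  πσ = π spσ
  ισ : Fam 𝒞 K₁ (_∘ᶠ_ 𝒞 (M R) (M S))
  ισ = ι spσ
  πλ : Fam 𝒞 (_∘ᶠ_ 𝒞 (M S) (M T)) K₂
  πλ = π spλ
  ιλ : Fam 𝒞 K₂ (_∘ᶠ_ 𝒞 (M S) (M T))
  ιλ = ι spλ
  κλ : Fam 𝒞 (_∘ᶠ_ 𝒞 (M S) (M T)) (_∘ᶠ_ 𝒞 (M S) (M T))
  κλ = κ 𝒞 S T λ′
  ηˢᵗ : ∀ X → Hom X (S₀ (T₀ X))
  ηˢᵗ = Wλ.ηᴬᴮ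
  μˢᵗ : ∀ X → Hom (S₀ (T₀ (S₀ (T₀ X)))) (S₀ (T₀ X))
  μˢᵗ = Wλ.μᴬᴮ
  μʳˢ : ∀ X → Hom (R₀ (S₀ (R₀ (S₀ X)))) (R₀ (S₀ X))
  μʳˢ = Wσ.μᴬᴮ

  RS₁ RST : Endofunctor 𝒞
  RS₁ = _∘ᶠ_ 𝒞 (M R) (M S)
  RST = _∘ᶠ_ 𝒞 RS₁ (M T)

  RS ST : MonadData 𝒞
  RS = weakComposite 𝒞 R S σ spσ
  ST = weakComposite 𝒞 S T λ′ spλ

  φ : Fam 𝒞 (_∘ᶠ_ 𝒞 (M T) K₁) (_∘ᶠ_ 𝒞 K₁ (M T))
  φ X = πσ (T₀ X) ∘ (R₁ (λ′ X) ∘ (τ (S₀ X) ∘ T₁ (ισ X)))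

  ψ : Fam 𝒞 (_∘ᶠ_ 𝒞 K₂ (M R)) (_∘ᶠ_ 𝒞 (M R) K₂)
  ψ X = R₁ (πλ X) ∘ (σ (T₀ X) ∘ (S₁ (τ X) ∘ ιλ (R₀ X)))

  -- ψ is Ψ transported along the splitting of κ^λ.
  Ψ : ∀ X → Hom (S₀ (T₀ (R₀ X))) (RST₀ X)
  Ψ X = σ (T₀ X) ∘ S₁ (τ X)

  Ψ-natural : ∀ {X Y} (f : Hom X Y) → Ψ Y ∘ S₁ (T₁ (R₁ f)) ≈ R₁ (S₁ (T₁ f)) ∘ Ψ X
  Ψ-natural f = begin
    (σ _ ∘ S₁ (τ _)) ∘ S₁ (T₁ (R₁ f)) ≈⟨ pullʳ (FS.resp-square (wτ.natural f)) ⟩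
    σ _ ∘ (S₁ (R₁ (T₁ f)) ∘ S₁ (τ _)) ≈⟨ pullˡ (wσ.natural (T₁ f)) ⟩
    (R₁ (S₁ (T₁ f)) ∘ σ _) ∘ S₁ (τ _) ≈⟨ assoc ⟩
    R₁ (S₁ (T₁ f)) ∘ Ψ _ ∎

  Ψ-κλ : ∀ Y → Ψ Y ∘ κλ (R₀ Y) ≈ R₁ (κλ Y) ∘ Ψ Y
  Ψ-κλ Y = begin
    (σ (T₀ Y) ∘ S₁ (τ Y)) ∘ (S₁ (μT (R₀ Y)) ∘ (λ′ (T₀ (R₀ Y)) ∘ ηT (S₀ (T₀ (R₀ Y)))))
      ≈⟨ pullʳ (pullˡ (FS.resp-triangle (wτ.μ⁻ Y))) ⟩
    σ (T₀ Y) ∘ (S₁ (R₁ (μT Y) ∘ (τ (T₀ Y) ∘ T₁ (τ Y))) ∘ (λ′ (T₀ (R₀ Y)) ∘ ηT (S₀ (T₀ (R₀ Y)))))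
      ≈⟨ refl⟩∘⟨ FS.resp-∘˘ ⟩∘⟨refl ⟩
    σ (T₀ Y) ∘ ((S₁ (R₁ (μT Y)) ∘ S₁ (τ (T₀ Y) ∘ T₁ (τ Y))) ∘ (λ′ (T₀ (R₀ Y)) ∘ ηT (S₀ (T₀ (R₀ Y)))))
      ≈⟨ refl⟩∘⟨ pullʳ (FS.resp-∘˘ ⟩∘⟨refl) ⟩
    σ (T₀ Y) ∘ (S₁ (R₁ (μT Y)) ∘ ((S₁ (τ (T₀ Y)) ∘ S₁ (T₁ (τ Y))) ∘ (λ′ (T₀ (R₀ Y)) ∘ ηT (S₀ (T₀ (R₀ Y))))))
      ≈⟨ pullˡ (wσ.natural (μT Y)) ⟩
    (R₁ (S₁ (μT Y)) ∘ σ (T₀ (T₀ Y))) ∘ ((S₁ (τ (T₀ Y)) ∘ S₁ (T₁ (τ Y))) ∘ (λ′ (T₀ (R₀ Y)) ∘ ηT (S₀ (T₀ (R₀ Y)))))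
      ≈⟨ assoc ⟩
    R₁ (S₁ (μT Y)) ∘ (σ (T₀ (T₀ Y)) ∘ ((S₁ (τ (T₀ Y)) ∘ S₁ (T₁ (τ Y))) ∘ (λ′ (T₀ (R₀ Y)) ∘ ηT (S₀ (T₀ (R₀ Y))))))
      ≈⟨ refl⟩∘⟨ refl⟩∘⟨ pullʳ (extendʳ (sym (wλ.natural (τ Y)))) ⟩
    R₁ (S₁ (μT Y)) ∘ (σ (T₀ (T₀ Y)) ∘ (S₁ (τ (T₀ Y)) ∘ (λ′ (R₀ (T₀ Y)) ∘ (T₁ (S₁ (τ Y)) ∘ ηT (S₀ (T₀ (R₀ Y)))))))
      ≈⟨ refl⟩∘⟨ pull₃ˡ (yang-baxter (T₀ Y)) ⟩
    R₁ (S₁ (μT Y)) ∘ ((R₁ (λ′ (T₀ Y)) ∘ (τ (S₀ (T₀ Y)) ∘ T₁ (σ (T₀ Y)))) ∘ (T₁ (S₁ (τ Y)) ∘ ηT (S₀ (T₀ (R₀ Y)))))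
      ≈⟨ refl⟩∘⟨ assoc ⟩
    R₁ (S₁ (μT Y)) ∘ (R₁ (λ′ (T₀ Y)) ∘ ((τ (S₀ (T₀ Y)) ∘ T₁ (σ (T₀ Y))) ∘ (T₁ (S₁ (τ Y)) ∘ ηT (S₀ (T₀ (R₀ Y))))))
      ≈⟨ refl⟩∘⟨ refl⟩∘⟨ assoc ⟩
    R₁ (S₁ (μT Y)) ∘ (R₁ (λ′ (T₀ Y)) ∘ (τ (S₀ (T₀ Y)) ∘ (T₁ (σ (T₀ Y)) ∘ (T₁ (S₁ (τ Y)) ∘ ηT (S₀ (T₀ (R₀ Y)))))))
      ≈⟨ refl⟩∘⟨ refl⟩∘⟨ refl⟩∘⟨ pullˡ FT.resp-∘ ⟩
    R₁ (S₁ (μT Y)) ∘ (R₁ (λ′ (T₀ Y)) ∘ (τ (S₀ (T₀ Y)) ∘ (T₁ (Ψ Y) ∘ ηT (S₀ (T₀ (R₀ Y))))))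
      ≈⟨ refl⟩∘⟨ refl⟩∘⟨ refl⟩∘⟨ mT.unit-nat (Ψ Y) ⟨
    R₁ (S₁ (μT Y)) ∘ (R₁ (λ′ (T₀ Y)) ∘ (τ (S₀ (T₀ Y)) ∘ (ηT (RST₀ Y) ∘ Ψ Y)))
      ≈⟨ refl⟩∘⟨ refl⟩∘⟨ pullˡ (dτ.η⁻ (S₀ (T₀ Y))) ⟩
    R₁ (S₁ (μT Y)) ∘ (R₁ (λ′ (T₀ Y)) ∘ (R₁ (ηT (S₀ (T₀ Y))) ∘ Ψ Y))
      ≈⟨ pull₃ˡ FR.resp-∘₃ ⟩
    R₁ (κλ Y) ∘ Ψ Y ∎

  Ψ-μˢᵗ : ∀ X → Ψ X ∘ μˢᵗ (R₀ X) ≈ R₁ (μˢᵗ X) ∘ (Ψ (S₀ (T₀ X)) ∘ S₁ (T₁ (Ψ X)))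
  Ψ-μˢᵗ X = trans lhs≈middle middle≈rhs
    where
    middle : Hom (S₀ (T₀ (S₀ (T₀ (R₀ X))))) (RST₀ X)
    middle = R₁ (μS (T₀ X)) ∘ (R₁ (S₁ (S₁ (μT X))) ∘ (σ (S₀ (T₀ (T₀ X))) ∘ (S₁ (R₁ (λ′ (T₀ X)) ∘ (τ (S₀ (T₀ X)) ∘ T₁ (σ (T₀ X)))) ∘ S₁ (T₁ (S₁ (τ X))))))

    lhs≈middle : Ψ X ∘ μˢᵗ (R₀ X) ≈ middle
    lhs≈middle = begin
      (σ (T₀ X) ∘ S₁ (τ X)) ∘ (μS (T₀ (R₀ X)) ∘ (S₁ (S₁ (μT (R₀ X))) ∘ S₁ (λ′ (T₀ (R₀ X)))))
        ≈⟨ pullʳ (extendʳ (sym (mS.mult-nat (τ X)))) ⟩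
      σ (T₀ X) ∘ (μS (R₀ (T₀ X)) ∘ (S₁ (S₁ (τ X)) ∘ (S₁ (S₁ (μT (R₀ X))) ∘ S₁ (λ′ (T₀ (R₀ X))))))
        ≈⟨ pullˡ (wσ.μ⁻ (T₀ X)) ⟩
      (R₁ (μS (T₀ X)) ∘ (σ (S₀ (T₀ X)) ∘ S₁ (σ (T₀ X)))) ∘ (S₁ (S₁ (τ X)) ∘ (S₁ (S₁ (μT (R₀ X))) ∘ S₁ (λ′ (T₀ (R₀ X)))))
        ≈⟨ assoc ⟩
      R₁ (μS (T₀ X)) ∘ ((σ (S₀ (T₀ X)) ∘ S₁ (σ (T₀ X))) ∘ (S₁ (S₁ (τ X)) ∘ (S₁ (S₁ (μT (R₀ X))) ∘ S₁ (λ′ (T₀ (R₀ X))))))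
        ≈⟨ refl⟩∘⟨ assoc ⟩
      R₁ (μS (T₀ X)) ∘ (σ (S₀ (T₀ X)) ∘ (S₁ (σ (T₀ X)) ∘ (S₁ (S₁ (τ X)) ∘ (S₁ (S₁ (μT (R₀ X))) ∘ S₁ (λ′ (T₀ (R₀ X)))))))
        ≈⟨ refl⟩∘⟨ refl⟩∘⟨ refl⟩∘⟨ pullˡ (FSS.resp-triangle (wτ.μ⁻ X)) ⟩
      R₁ (μS (T₀ X)) ∘ (σ (S₀ (T₀ X)) ∘ (S₁ (σ (T₀ X)) ∘ (S₁ (S₁ (R₁ (μT X) ∘ (τ (T₀ X) ∘ T₁ (τ X)))) ∘ S₁ (λ′ (T₀ (R₀ X))))))
        ≈⟨ refl⟩∘⟨ refl⟩∘⟨ refl⟩∘⟨ FSS.resp-∘˘ ⟩∘⟨refl ⟩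
      R₁ (μS (T₀ X)) ∘ (σ (S₀ (T₀ X)) ∘ (S₁ (σ (T₀ X)) ∘ ((S₁ (S₁ (R₁ (μT X))) ∘ S₁ (S₁ (τ (T₀ X) ∘ T₁ (τ X)))) ∘ S₁ (λ′ (T₀ (R₀ X))))))
        ≈⟨ refl⟩∘⟨ refl⟩∘⟨ refl⟩∘⟨ pullʳ (FSS.resp-∘˘ ⟩∘⟨refl) ⟩
      R₁ (μS (T₀ X)) ∘ (σ (S₀ (T₀ X)) ∘ (S₁ (σ (T₀ X)) ∘ (S₁ (S₁ (R₁ (μT X))) ∘ ((S₁ (S₁ (τ (T₀ X))) ∘ S₁ (S₁ (T₁ (τ X)))) ∘ S₁ (λ′ (T₀ (R₀ X)))))))
        ≈⟨ refl⟩∘⟨ refl⟩∘⟨ extendʳ (FS.resp-square (wσ.natural (μT X))) ⟩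
      R₁ (μS (T₀ X)) ∘ (σ (S₀ (T₀ X)) ∘ (S₁ (R₁ (S₁ (μT X))) ∘ (S₁ (σ (T₀ (T₀ X))) ∘ ((S₁ (S₁ (τ (T₀ X))) ∘ S₁ (S₁ (T₁ (τ X)))) ∘ S₁ (λ′ (T₀ (R₀ X)))))))
        ≈⟨ refl⟩∘⟨ extendʳ (wσ.natural (S₁ (μT X))) ⟩
      R₁ (μS (T₀ X)) ∘ (R₁ (S₁ (S₁ (μT X))) ∘ (σ (S₀ (T₀ (T₀ X))) ∘ (S₁ (σ (T₀ (T₀ X))) ∘ ((S₁ (S₁ (τ (T₀ X))) ∘ S₁ (S₁ (T₁ (τ X)))) ∘ S₁ (λ′ (T₀ (R₀ X)))))))
        ≈⟨ refl⟩∘⟨ refl⟩∘⟨ refl⟩∘⟨ refl⟩∘⟨ pullʳ (FS.resp-square (sym (wλ.natural (τ X)))) ⟩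
      R₁ (μS (T₀ X)) ∘ (R₁ (S₁ (S₁ (μT X))) ∘ (σ (S₀ (T₀ (T₀ X))) ∘ (S₁ (σ (T₀ (T₀ X))) ∘ (S₁ (S₁ (τ (T₀ X))) ∘ (S₁ (λ′ (R₀ (T₀ X))) ∘ S₁ (T₁ (S₁ (τ X))))))))
        ≈⟨ refl⟩∘⟨ refl⟩∘⟨ refl⟩∘⟨ pull₃ˡ (trans FS.resp-∘₃ (FS.resp-≈ (yang-baxter (T₀ X)))) ⟩
      middle ∎

    middle≈rhs : middle ≈ R₁ (μˢᵗ X) ∘ (Ψ (S₀ (T₀ X)) ∘ S₁ (T₁ (Ψ X)))
    middle≈rhs = begin
      middle
        ≈⟨ refl⟩∘⟨ refl⟩∘⟨ refl⟩∘⟨ (FS.resp-∘˘ ⟩∘⟨refl) ⟩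
      R₁ (μS (T₀ X)) ∘ (R₁ (S₁ (S₁ (μT X))) ∘ (σ (S₀ (T₀ (T₀ X))) ∘ ((S₁ (R₁ (λ′ (T₀ X))) ∘ S₁ (τ (S₀ (T₀ X)) ∘ T₁ (σ (T₀ X)))) ∘ S₁ (T₁ (S₁ (τ X))))))
        ≈⟨ refl⟩∘⟨ refl⟩∘⟨ refl⟩∘⟨ assoc ⟩
      R₁ (μS (T₀ X)) ∘ (R₁ (S₁ (S₁ (μT X))) ∘ (σ (S₀ (T₀ (T₀ X))) ∘ (S₁ (R₁ (λ′ (T₀ X))) ∘ (S₁ (τ (S₀ (T₀ X)) ∘ T₁ (σ (T₀ X))) ∘ S₁ (T₁ (S₁ (τ X)))))))
        ≈⟨ refl⟩∘⟨ refl⟩∘⟨ extendʳ (wσ.natural (λ′ (T₀ X))) ⟩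
      R₁ (μS (T₀ X)) ∘ (R₁ (S₁ (S₁ (μT X))) ∘ (R₁ (S₁ (λ′ (T₀ X))) ∘ (σ (T₀ (S₀ (T₀ X))) ∘ (S₁ (τ (S₀ (T₀ X)) ∘ T₁ (σ (T₀ X))) ∘ S₁ (T₁ (S₁ (τ X)))))))
        ≈⟨ pull₃ˡ FR.resp-∘₃ ⟩
      R₁ (μˢᵗ X) ∘ (σ (T₀ (S₀ (T₀ X))) ∘ (S₁ (τ (S₀ (T₀ X)) ∘ T₁ (σ (T₀ X))) ∘ S₁ (T₁ (S₁ (τ X)))))
        ≈⟨ refl⟩∘⟨ refl⟩∘⟨ (FS.resp-∘˘ ⟩∘⟨refl) ⟩
      R₁ (μˢᵗ X) ∘ (σ (T₀ (S₀ (T₀ X))) ∘ ((S₁ (τ (S₀ (T₀ X))) ∘ S₁ (T₁ (σ (T₀ X)))) ∘ S₁ (T₁ (S₁ (τ X)))))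
        ≈⟨ refl⟩∘⟨ refl⟩∘⟨ pullʳ FST.resp-∘ ⟩
      R₁ (μˢᵗ X) ∘ (σ (T₀ (S₀ (T₀ X))) ∘ (S₁ (τ (S₀ (T₀ X))) ∘ S₁ (T₁ (Ψ X))))
        ≈⟨ refl⟩∘⟨ sym-assoc ⟩
      R₁ (μˢᵗ X) ∘ (Ψ (S₀ (T₀ X)) ∘ S₁ (T₁ (Ψ X))) ∎

  a b aba κΨ : Fam 𝒞 RST RST
  a X = ισ (T₀ X) ∘ πσ (T₀ X)
  b X = R₁ (κλ X)
  aba X = a X ∘ (b X ∘ a X)
  κΨ X = R₁ (μˢᵗ X) ∘ (Ψ (S₀ (T₀ X)) ∘ ηˢᵗ (RST₀ X))

  μˢᵗ-Sηᵀ : ∀ X → μˢᵗ X ∘ S₁ (ηT (S₀ (T₀ X))) ≈ μS (T₀ X) ∘ S₁ (κλ X)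
  μˢᵗ-Sηᵀ X = trans assoc (trans (refl⟩∘⟨ assoc) (refl⟩∘⟨ FS.resp-∘₃))

  a∘b≈κΨ : ∀ X → a X ∘ b X ≈ κΨ X
  a∘b≈κΨ X = trans left (sym right)
    where
    left : a X ∘ b X ≈ R₁ (μS (T₀ X) ∘ S₁ (κλ X)) ∘ (σ (S₀ (T₀ X)) ∘ ηS (RST₀ X))
    left = begin
      a X ∘ b X ≈⟨ ι∘π spσ (T₀ X) ⟩∘⟨refl ⟩
      (R₁ (μS (T₀ X)) ∘ (σ (S₀ (T₀ X)) ∘ ηS (RST₀ X))) ∘ R₁ (κλ X)
        ≈⟨ pullʳ (pullʳ (mS.unit-nat (R₁ (κλ X)))) ⟩
      R₁ (μS (T₀ X)) ∘ (σ (S₀ (T₀ X)) ∘ (S₁ (R₁ (κλ X)) ∘ ηS (RST₀ X)))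
        ≈⟨ refl⟩∘⟨ extendʳ (wσ.natural (κλ X)) ⟩
      R₁ (μS (T₀ X)) ∘ (R₁ (S₁ (κλ X)) ∘ (σ (S₀ (T₀ X)) ∘ ηS (RST₀ X)))
        ≈⟨ pullˡ FR.resp-∘ ⟩
      R₁ (μS (T₀ X) ∘ S₁ (κλ X)) ∘ (σ (S₀ (T₀ X)) ∘ ηS (RST₀ X)) ∎
    right : κΨ X ≈ R₁ (μS (T₀ X) ∘ S₁ (κλ X)) ∘ (σ (S₀ (T₀ X)) ∘ ηS (RST₀ X))
    right = begin
      R₁ (μˢᵗ X) ∘ ((σ (T₀ (S₀ (T₀ X))) ∘ S₁ (τ (S₀ (T₀ X)))) ∘ (S₁ (ηT (RST₀ X)) ∘ ηS (RST₀ X)))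
        ≈⟨ refl⟩∘⟨ assoc ⟩
      R₁ (μˢᵗ X) ∘ (σ (T₀ (S₀ (T₀ X))) ∘ (S₁ (τ (S₀ (T₀ X))) ∘ (S₁ (ηT (RST₀ X)) ∘ ηS (RST₀ X))))
        ≈⟨ refl⟩∘⟨ refl⟩∘⟨ pullˡ (FS.resp-triangle (dτ.η⁻ (S₀ (T₀ X)))) ⟩
      R₁ (μˢᵗ X) ∘ (σ (T₀ (S₀ (T₀ X))) ∘ (S₁ (R₁ (ηT (S₀ (T₀ X)))) ∘ ηS (RST₀ X)))
        ≈⟨ refl⟩∘⟨ extendʳ (wσ.natural (ηT (S₀ (T₀ X)))) ⟩
      R₁ (μˢᵗ X) ∘ (R₁ (S₁ (ηT (S₀ (T₀ X)))) ∘ (σ (S₀ (T₀ X)) ∘ ηS (RST₀ X)))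
        ≈⟨ pullˡ (FR.resp-triangle (μˢᵗ-Sηᵀ X)) ⟩
      R₁ (μS (T₀ X) ∘ S₁ (κλ X)) ∘ (σ (S₀ (T₀ X)) ∘ ηS (RST₀ X)) ∎

  κΨ-idempotent : ∀ X → κΨ X ∘ κΨ X ≈ κΨ X
  κΨ-idempotent X = begin
    (R₁ (μˢᵗ X) ∘ (Ψ (S₀ (T₀ X)) ∘ ηˢᵗ (RST₀ X))) ∘ κΨ X
      ≈⟨ pullʳ (pullʳ (Wλ.ηᴬᴮ-natural (κΨ X))) ⟩
    R₁ (μˢᵗ X) ∘ (Ψ (S₀ (T₀ X)) ∘ (S₁ (T₁ (κΨ X)) ∘ ηˢᵗ (RST₀ X)))
      ≈⟨ refl⟩∘⟨ refl⟩∘⟨ (trans FST.resp-∘˘ (refl⟩∘⟨ FST.resp-∘˘)) ⟩∘⟨refl ⟩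
    R₁ (μˢᵗ X) ∘ (Ψ (S₀ (T₀ X)) ∘ ((S₁ (T₁ (R₁ (μˢᵗ X))) ∘ (S₁ (T₁ (Ψ (S₀ (T₀ X)))) ∘ S₁ (T₁ (ηˢᵗ (RST₀ X))))) ∘ ηˢᵗ (RST₀ X)))
      ≈⟨ refl⟩∘⟨ refl⟩∘⟨ trans assoc (refl⟩∘⟨ assoc) ⟩
    R₁ (μˢᵗ X) ∘ (Ψ (S₀ (T₀ X)) ∘ (S₁ (T₁ (R₁ (μˢᵗ X))) ∘ (S₁ (T₁ (Ψ (S₀ (T₀ X)))) ∘ (S₁ (T₁ (ηˢᵗ (RST₀ X))) ∘ ηˢᵗ (RST₀ X)))))
      ≈⟨ refl⟩∘⟨ extendʳ (Ψ-natural (μˢᵗ X)) ⟩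
    R₁ (μˢᵗ X) ∘ (R₁ (S₁ (T₁ (μˢᵗ X))) ∘ (Ψ (S₀ (T₀ (S₀ (T₀ X)))) ∘ (S₁ (T₁ (Ψ (S₀ (T₀ X)))) ∘ (S₁ (T₁ (ηˢᵗ (RST₀ X))) ∘ ηˢᵗ (RST₀ X)))))
      ≈⟨ extendʳ (FR.resp-square (sym (Wλ.μᴬᴮ-assoc X))) ⟩
    R₁ (μˢᵗ X) ∘ (R₁ (μˢᵗ (S₀ (T₀ X))) ∘ (Ψ (S₀ (T₀ (S₀ (T₀ X)))) ∘ (S₁ (T₁ (Ψ (S₀ (T₀ X)))) ∘ (S₁ (T₁ (ηˢᵗ (RST₀ X))) ∘ ηˢᵗ (RST₀ X)))))
      ≈⟨ refl⟩∘⟨ pull₃ˡ (sym (Ψ-μˢᵗ (S₀ (T₀ X)))) ⟩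
    R₁ (μˢᵗ X) ∘ ((Ψ (S₀ (T₀ X)) ∘ μˢᵗ (RST₀ X)) ∘ (S₁ (T₁ (ηˢᵗ (RST₀ X))) ∘ ηˢᵗ (RST₀ X)))
      ≈⟨ refl⟩∘⟨ pullʳ (cancelˡ (Wλ.μᴬᴮ-unitˡ _)) ⟩
    κΨ X ∎

  b-idempotent : ∀ X → b X ∘ b X ≈ b X
  b-idempotent X = FR.resp-triangle (splitting-idempotent spλ X)

  abab≈ab : ∀ X {A} {f : Hom A (RST₀ X)} → a X ∘ (b X ∘ (a X ∘ (b X ∘ f))) ≈ a X ∘ (b X ∘ f)
  abab≈ab X {f = f} = begin
    a X ∘ (b X ∘ (a X ∘ (b X ∘ f))) ≈⟨ sym-assoc ⟩
    (a X ∘ b X) ∘ (a X ∘ (b X ∘ f)) ≈⟨ a∘b≈κΨ X ⟩∘⟨ (trans sym-assoc (a∘b≈κΨ X ⟩∘⟨refl)) ⟩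
    κΨ X ∘ (κΨ X ∘ f) ≈⟨ pullˡ (κΨ-idempotent X) ⟩
    κΨ X ∘ f ≈⟨ a∘b≈κΨ X ⟩∘⟨refl ⟨
    (a X ∘ b X) ∘ f ≈⟨ assoc ⟩
    a X ∘ (b X ∘ f) ∎

  abababa≈aba : ∀ X {A} {f : Hom A (RST₀ X)} →
         a X ∘ (b X ∘ (a X ∘ (b X ∘ (a X ∘ (b X ∘ (a X ∘ f)))))) ≈ a X ∘ (b X ∘ (a X ∘ f))
  abababa≈aba X = trans (abab≈ab X) (abab≈ab X)

  Rι∘Rπ≈b : ∀ X → R₁ (ιλ X) ∘ R₁ (πλ X) ≈ b X
  Rι∘Rπ≈b X = FR.resp-triangle (ι∘π spλ X)

  ισπσ-natural : IsNatural 𝒞 RS₁ RS₁ (λ X → ισ X ∘ πσ X)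
  ισπσ-natural = natural-∘ RS₁ K₁ RS₁ (ι-nat spσ) (π-nat spσ)

  κφ : Fam 𝒞 (_∘ᶠ_ 𝒞 K₁ (M T)) (_∘ᶠ_ 𝒞 K₁ (M T))
  κφ = κ 𝒞 RS T φ

  κψ : Fam 𝒞 (_∘ᶠ_ 𝒞 (M R) K₂) (_∘ᶠ_ 𝒞 (M R) K₂)
  κψ = κ 𝒞 R ST ψ

  ισ∘κφ∘πσ≈aba : ∀ X → ισ (T₀ X) ∘ (κφ X ∘ πσ (T₀ X)) ≈ a X ∘ (b X ∘ a X)
  ισ∘κφ∘πσ≈aba X = begin
    ισ (T₀ X) ∘ ((F₁ K₁ (μT X) ∘ (φ (T₀ X) ∘ ηT (F₀ K₁ (T₀ X)))) ∘ πσ (T₀ X))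
      ≈⟨ refl⟩∘⟨ trans assoc (refl⟩∘⟨ assoc) ⟩
    ισ (T₀ X) ∘ (F₁ K₁ (μT X) ∘ (φ (T₀ X) ∘ (ηT (F₀ K₁ (T₀ X)) ∘ πσ (T₀ X))))
      ≈⟨ refl⟩∘⟨ refl⟩∘⟨ refl⟩∘⟨ mT.unit-nat (πσ (T₀ X)) ⟩
    ισ (T₀ X) ∘ (F₁ K₁ (μT X) ∘ (φ (T₀ X) ∘ (T₁ (πσ (T₀ X)) ∘ ηT (RST₀ X))))
      ≈⟨ refl⟩∘⟨ refl⟩∘⟨ assoc³ ⟩
    ισ (T₀ X) ∘ (F₁ K₁ (μT X) ∘ (πσ (T₀ (T₀ X)) ∘ (R₁ (λ′ (T₀ X)) ∘ (τ (S₀ (T₀ X)) ∘ (T₁ (ισ (T₀ X)) ∘ (T₁ (πσ (T₀ X)) ∘ ηT (RST₀ X)))))))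
      ≈⟨ refl⟩∘⟨ refl⟩∘⟨ refl⟩∘⟨ refl⟩∘⟨ refl⟩∘⟨ pullˡ FT.resp-∘ ⟩
    ισ (T₀ X) ∘ (F₁ K₁ (μT X) ∘ (πσ (T₀ (T₀ X)) ∘ (R₁ (λ′ (T₀ X)) ∘ (τ (S₀ (T₀ X)) ∘ (T₁ (a X) ∘ ηT (RST₀ X))))))
      ≈⟨ refl⟩∘⟨ refl⟩∘⟨ refl⟩∘⟨ refl⟩∘⟨ refl⟩∘⟨ mT.unit-nat (a X) ⟨
    ισ (T₀ X) ∘ (F₁ K₁ (μT X) ∘ (πσ (T₀ (T₀ X)) ∘ (R₁ (λ′ (T₀ X)) ∘ (τ (S₀ (T₀ X)) ∘ (ηT (RST₀ X) ∘ a X)))))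
      ≈⟨ refl⟩∘⟨ refl⟩∘⟨ refl⟩∘⟨ refl⟩∘⟨ pullˡ (dτ.η⁻ (S₀ (T₀ X))) ⟩
    ισ (T₀ X) ∘ (F₁ K₁ (μT X) ∘ (πσ (T₀ (T₀ X)) ∘ (R₁ (λ′ (T₀ X)) ∘ (R₁ (ηT (S₀ (T₀ X))) ∘ a X))))
      ≈⟨ refl⟩∘⟨ extendʳ (sym (π-nat spσ (μT X))) ⟩
    ισ (T₀ X) ∘ (πσ (T₀ X) ∘ (R₁ (S₁ (μT X)) ∘ (R₁ (λ′ (T₀ X)) ∘ (R₁ (ηT (S₀ (T₀ X))) ∘ a X))))
      ≈⟨ sym-assoc ⟩
    a X ∘ (R₁ (S₁ (μT X)) ∘ (R₁ (λ′ (T₀ X)) ∘ (R₁ (ηT (S₀ (T₀ X))) ∘ a X)))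
      ≈⟨ refl⟩∘⟨ pull₃ˡ FR.resp-∘₃ ⟩
    a X ∘ (b X ∘ a X) ∎

  module STᶜ = Wλ.WeakComposite spλ

  Rι∘Rmult∘ψ : ∀ X → R₁ (ιλ X ∘ mult ST X) ∘ ψ (F₀ K₂ X)
               ≈ R₁ (κλ X ∘ μˢᵗ X) ∘ (Ψ (S₀ (T₀ X)) ∘ (ιλ (RST₀ X) ∘ F₁ K₂ (R₁ (ιλ X))))
  Rι∘Rmult∘ψ X = begin
    R₁ (ιλ X ∘ mult ST X) ∘ (R₁ (πλ (F₀ K₂ X)) ∘ (σ _ ∘ (S₁ (τ _) ∘ ιλ (R₀ (F₀ K₂ X)))))
      ≈⟨ pullˡ (FR.resp-triangle (STᶜ.ι∘mult∘π≈κ∘μᴬᴮ X)) ⟩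
    R₁ (κλ X ∘ (μˢᵗ X ∘ S₁ (T₁ (ιλ X)))) ∘ (σ _ ∘ (S₁ (τ _) ∘ ιλ (R₀ (F₀ K₂ X))))
      ≈⟨ trans (FR.resp-≈ sym-assoc) FR.resp-∘˘ ⟩∘⟨ sym-assoc ⟩
    (R₁ (κλ X ∘ μˢᵗ X) ∘ R₁ (S₁ (T₁ (ιλ X)))) ∘ (Ψ (F₀ K₂ X) ∘ ιλ (R₀ (F₀ K₂ X)))
      ≈⟨ assoc ⟩
    R₁ (κλ X ∘ μˢᵗ X) ∘ (R₁ (S₁ (T₁ (ιλ X))) ∘ (Ψ (F₀ K₂ X) ∘ ιλ (R₀ (F₀ K₂ X))))
      ≈⟨ refl⟩∘⟨ extendʳ (Ψ-natural (ιλ X)) ⟨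
    R₁ (κλ X ∘ μˢᵗ X) ∘ (Ψ (S₀ (T₀ X)) ∘ (S₁ (T₁ (R₁ (ιλ X))) ∘ ιλ (R₀ (F₀ K₂ X))))
      ≈⟨ refl⟩∘⟨ refl⟩∘⟨ ι-nat spλ (R₁ (ιλ X)) ⟨
    R₁ (κλ X ∘ μˢᵗ X) ∘ (Ψ (S₀ (T₀ X)) ∘ (ιλ (RST₀ X) ∘ F₁ K₂ (R₁ (ιλ X)))) ∎

  Rι∘κψ∘Rπ≈bab : ∀ X → R₁ (ιλ X) ∘ (κψ X ∘ R₁ (πλ X)) ≈ b X ∘ (a X ∘ b X)
  Rι∘κψ∘Rπ≈bab X = begin
    R₁ (ιλ X) ∘ ((R₁ (mult ST X) ∘ (ψ (F₀ K₂ X) ∘ unit ST (R₀ (F₀ K₂ X)))) ∘ R₁ (πλ X))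
      ≈⟨ refl⟩∘⟨ trans assoc (refl⟩∘⟨ assoc) ⟩
    R₁ (ιλ X) ∘ (R₁ (mult ST X) ∘ (ψ (F₀ K₂ X) ∘ (unit ST (R₀ (F₀ K₂ X)) ∘ R₁ (πλ X))))
      ≈⟨ pullˡ FR.resp-∘ ⟩
    R₁ (ιλ X ∘ mult ST X) ∘ (ψ (F₀ K₂ X) ∘ (unit ST (R₀ (F₀ K₂ X)) ∘ R₁ (πλ X)))
      ≈⟨ trans (pullˡ (Rι∘Rmult∘ψ X)) assoc³ ⟩
    R₁ (κλ X ∘ μˢᵗ X) ∘ (Ψ (S₀ (T₀ X)) ∘ (ιλ (RST₀ X) ∘ (F₁ K₂ (R₁ (ιλ X)) ∘ (unit ST (R₀ (F₀ K₂ X)) ∘ R₁ (πλ X)))))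
      ≈⟨ refl⟩∘⟨ refl⟩∘⟨ extendʳ (ι-nat spλ (R₁ (ιλ X))) ⟩
    R₁ (κλ X ∘ μˢᵗ X) ∘ (Ψ (S₀ (T₀ X)) ∘ (S₁ (T₁ (R₁ (ιλ X))) ∘ (ιλ (R₀ (F₀ K₂ X)) ∘ (unit ST (R₀ (F₀ K₂ X)) ∘ R₁ (πλ X)))))
      ≈⟨ refl⟩∘⟨ refl⟩∘⟨ refl⟩∘⟨ pullˡ (STᶜ.ι∘unit≈ηᴬᴮ _) ⟩
    R₁ (κλ X ∘ μˢᵗ X) ∘ (Ψ (S₀ (T₀ X)) ∘ (S₁ (T₁ (R₁ (ιλ X))) ∘ (ηˢᵗ (R₀ (F₀ K₂ X)) ∘ R₁ (πλ X))))
      ≈⟨ refl⟩∘⟨ refl⟩∘⟨ extendʳ (Wλ.ηᴬᴮ-natural (R₁ (ιλ X))) ⟨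
    R₁ (κλ X ∘ μˢᵗ X) ∘ (Ψ (S₀ (T₀ X)) ∘ (ηˢᵗ (RST₀ X) ∘ (R₁ (ιλ X) ∘ R₁ (πλ X))))
      ≈⟨ refl⟩∘⟨ refl⟩∘⟨ refl⟩∘⟨ Rι∘Rπ≈b X ⟩
    R₁ (κλ X ∘ μˢᵗ X) ∘ (Ψ (S₀ (T₀ X)) ∘ (ηˢᵗ (RST₀ X) ∘ b X))
      ≈⟨ trans (FR.resp-∘˘ ⟩∘⟨refl) (trans assoc (refl⟩∘⟨ sym (trans assoc (refl⟩∘⟨ assoc)))) ⟩
    b X ∘ (κΨ X ∘ b X)
      ≈⟨ refl⟩∘⟨ a∘b≈κΨ X ⟩∘⟨refl ⟨
    b X ∘ ((a X ∘ b X) ∘ b X)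
      ≈⟨ refl⟩∘⟨ pullʳ (b-idempotent X) ⟩
    b X ∘ (a X ∘ b X) ∎

  μᴿ⁽ˢᵀ⁾ : ∀ X → Hom (RST₀ (RST₀ X)) (RST₀ X)
  μᴿ⁽ˢᵀ⁾ X = μR (S₀ (T₀ X)) ∘ (R₁ (R₁ (μˢᵗ X)) ∘ R₁ (Ψ (S₀ (T₀ X))))

  μ⁽ᴿˢ⁾ᵀ : ∀ X → Hom (RST₀ (RST₀ X)) (RST₀ X)
  μ⁽ᴿˢ⁾ᵀ X = R₁ (S₁ (μT X)) ∘ (μʳˢ (T₀ (T₀ X)) ∘ (R₁ (S₁ (R₁ (λ′ (T₀ X)))) ∘ R₁ (S₁ (τ (S₀ (T₀ X))))))

  μ⁽ᴿˢ⁾ᵀ≈μᴿ⁽ˢᵀ⁾ : ∀ X → μ⁽ᴿˢ⁾ᵀ X ≈ μᴿ⁽ˢᵀ⁾ X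
  μ⁽ᴿˢ⁾ᵀ≈μᴿ⁽ˢᵀ⁾ X = begin
    R₁ (S₁ (μT X)) ∘ ((μR _ ∘ (R₁ (R₁ (μS _)) ∘ R₁ (σ _))) ∘ (R₁ (S₁ (R₁ (λ′ (T₀ X)))) ∘ R₁ (S₁ (τ (S₀ (T₀ X))))))
      ≈⟨ refl⟩∘⟨ trans assoc (refl⟩∘⟨ assoc) ⟩
    R₁ (S₁ (μT X)) ∘ (μR _ ∘ (R₁ (R₁ (μS _)) ∘ (R₁ (σ _) ∘ (R₁ (S₁ (R₁ (λ′ (T₀ X)))) ∘ R₁ (S₁ (τ (S₀ (T₀ X))))))))
      ≈⟨ extendʳ (sym (mR.mult-nat (S₁ (μT X)))) ⟩
    μR _ ∘ (R₁ (R₁ (S₁ (μT X))) ∘ (R₁ (R₁ (μS _)) ∘ (R₁ (σ _) ∘ (R₁ (S₁ (R₁ (λ′ (T₀ X)))) ∘ R₁ (S₁ (τ (S₀ (T₀ X))))))))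
      ≈⟨ refl⟩∘⟨ refl⟩∘⟨ refl⟩∘⟨ extendʳ (FR.resp-square (wσ.natural (λ′ (T₀ X)))) ⟩
    μR _ ∘ (R₁ (R₁ (S₁ (μT X))) ∘ (R₁ (R₁ (μS _)) ∘ (R₁ (R₁ (S₁ (λ′ (T₀ X)))) ∘ (R₁ (σ _) ∘ R₁ (S₁ (τ (S₀ (T₀ X))))))))
      ≈⟨ refl⟩∘⟨ extendʳ (FRR.resp-square (sym (mS.mult-nat (μT X)))) ⟩
    μR _ ∘ (R₁ (R₁ (μS _)) ∘ (R₁ (R₁ (S₁ (S₁ (μT X)))) ∘ (R₁ (R₁ (S₁ (λ′ (T₀ X)))) ∘ (R₁ (σ _) ∘ R₁ (S₁ (τ (S₀ (T₀ X))))))))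
      ≈⟨ refl⟩∘⟨ pull₃ˡ FRR.resp-∘₃ ⟩
    μR _ ∘ (R₁ (R₁ (μˢᵗ X)) ∘ (R₁ (σ _) ∘ R₁ (S₁ (τ (S₀ (T₀ X))))))
      ≈⟨ refl⟩∘⟨ refl⟩∘⟨ FR.resp-∘ ⟩
    μᴿ⁽ˢᵀ⁾ X ∎

  μᴿ⁽ˢᵀ⁾∘b≈b∘μᴿ⁽ˢᵀ⁾ : ∀ X → μᴿ⁽ˢᵀ⁾ X ∘ b (RST₀ X) ≈ b X ∘ μᴿ⁽ˢᵀ⁾ X
  μᴿ⁽ˢᵀ⁾∘b≈b∘μᴿ⁽ˢᵀ⁾ X = begin
    (μR _ ∘ (R₁ (R₁ (μˢᵗ X)) ∘ R₁ (Ψ (S₀ (T₀ X))))) ∘ R₁ (κλ (RST₀ X))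
      ≈⟨ pullʳ (pullʳ (FR.resp-square (Ψ-κλ (S₀ (T₀ X))))) ⟩
    μR _ ∘ (R₁ (R₁ (μˢᵗ X)) ∘ (R₁ (R₁ (κλ (S₀ (T₀ X)))) ∘ R₁ (Ψ (S₀ (T₀ X)))))
      ≈⟨ refl⟩∘⟨ extendʳ (FRR.resp-square (Wλ.μᴬᴮ-κ-commute X)) ⟩
    μR _ ∘ (R₁ (R₁ (κλ X)) ∘ (R₁ (R₁ (μˢᵗ X)) ∘ R₁ (Ψ (S₀ (T₀ X)))))
      ≈⟨ pullˡ (mR.mult-nat (κλ X)) ⟩
    (b X ∘ μR _) ∘ (R₁ (R₁ (μˢᵗ X)) ∘ R₁ (Ψ (S₀ (T₀ X))))
      ≈⟨ assoc ⟩
    b X ∘ μᴿ⁽ˢᵀ⁾ X ∎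

  μᴿ⁽ˢᵀ⁾∘RSTb≈μᴿ⁽ˢᵀ⁾ : ∀ X → μᴿ⁽ˢᵀ⁾ X ∘ R₁ (S₁ (T₁ (b X))) ≈ μᴿ⁽ˢᵀ⁾ X
  μᴿ⁽ˢᵀ⁾∘RSTb≈μᴿ⁽ˢᵀ⁾ X = begin
    (μR _ ∘ (R₁ (R₁ (μˢᵗ X)) ∘ R₁ (Ψ (S₀ (T₀ X))))) ∘ R₁ (S₁ (T₁ (R₁ (κλ X))))
      ≈⟨ pullʳ (pullʳ (FR.resp-square (Ψ-natural (κλ X)))) ⟩
    μR _ ∘ (R₁ (R₁ (μˢᵗ X)) ∘ (R₁ (R₁ (S₁ (T₁ (κλ X)))) ∘ R₁ (Ψ (S₀ (T₀ X)))))
      ≈⟨ refl⟩∘⟨ pullˡ (FRR.resp-triangle (Wλ.μᴬᴮ-absorbs-κ X)) ⟩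
    μᴿ⁽ˢᵀ⁾ X ∎

  μ⁽ᴿˢ⁾ᵀ∘a≈a∘μ⁽ᴿˢ⁾ᵀ : ∀ X → μ⁽ᴿˢ⁾ᵀ X ∘ a (RST₀ X) ≈ a X ∘ μ⁽ᴿˢ⁾ᵀ X
  μ⁽ᴿˢ⁾ᵀ∘a≈a∘μ⁽ᴿˢ⁾ᵀ X = begin
    (R₁ (S₁ (μT X)) ∘ (μʳˢ (T₀ (T₀ X)) ∘ (R₁ (S₁ (R₁ (λ′ (T₀ X)))) ∘ R₁ (S₁ (τ (S₀ (T₀ X))))))) ∘ a (RST₀ X)
      ≈⟨ trans assoc (refl⟩∘⟨ trans assoc (refl⟩∘⟨ (FRS.resp-∘ ⟩∘⟨refl))) ⟩
    R₁ (S₁ (μT X)) ∘ (μʳˢ (T₀ (T₀ X)) ∘ (R₁ (S₁ (R₁ (λ′ (T₀ X)) ∘ τ (S₀ (T₀ X)))) ∘ a (RST₀ X)))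
      ≈⟨ refl⟩∘⟨ refl⟩∘⟨ ισπσ-natural (R₁ (λ′ (T₀ X)) ∘ τ (S₀ (T₀ X))) ⟨
    R₁ (S₁ (μT X)) ∘ (μʳˢ (T₀ (T₀ X)) ∘ ((ισ (RST₀ (T₀ X)) ∘ πσ (RST₀ (T₀ X))) ∘ R₁ (S₁ (R₁ (λ′ (T₀ X)) ∘ τ (S₀ (T₀ X))))))
      ≈⟨ refl⟩∘⟨ pullˡ (trans (refl⟩∘⟨ ι∘π spσ _) (trans (Wσ.μᴬᴮ-κ-commute (T₀ (T₀ X))) (sym (ι∘π spσ _) ⟩∘⟨refl))) ⟩
    R₁ (S₁ (μT X)) ∘ (((ισ (T₀ (T₀ X)) ∘ πσ (T₀ (T₀ X))) ∘ μʳˢ (T₀ (T₀ X))) ∘ R₁ (S₁ (R₁ (λ′ (T₀ X)) ∘ τ (S₀ (T₀ X)))))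
      ≈⟨ refl⟩∘⟨ assoc ⟩
    R₁ (S₁ (μT X)) ∘ ((ισ (T₀ (T₀ X)) ∘ πσ (T₀ (T₀ X))) ∘ (μʳˢ (T₀ (T₀ X)) ∘ R₁ (S₁ (R₁ (λ′ (T₀ X)) ∘ τ (S₀ (T₀ X))))))
      ≈⟨ extendʳ (ισπσ-natural (μT X)) ⟨
    a X ∘ (R₁ (S₁ (μT X)) ∘ (μʳˢ (T₀ (T₀ X)) ∘ R₁ (S₁ (R₁ (λ′ (T₀ X)) ∘ τ (S₀ (T₀ X))))))
      ≈⟨ refl⟩∘⟨ refl⟩∘⟨ refl⟩∘⟨ FRS.resp-∘˘ ⟩
    a X ∘ μ⁽ᴿˢ⁾ᵀ X ∎

  μᴿ⁽ˢᵀ⁾∘a≈a∘μᴿ⁽ˢᵀ⁾ : ∀ X → μᴿ⁽ˢᵀ⁾ X ∘ a (RST₀ X) ≈ a X ∘ μᴿ⁽ˢᵀ⁾ X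
  μᴿ⁽ˢᵀ⁾∘a≈a∘μᴿ⁽ˢᵀ⁾ X = begin
    μᴿ⁽ˢᵀ⁾ X ∘ a (RST₀ X) ≈⟨ μ⁽ᴿˢ⁾ᵀ≈μᴿ⁽ˢᵀ⁾ X ⟩∘⟨refl ⟨
    μ⁽ᴿˢ⁾ᵀ X ∘ a (RST₀ X) ≈⟨ μ⁽ᴿˢ⁾ᵀ∘a≈a∘μ⁽ᴿˢ⁾ᵀ X ⟩
    a X ∘ μ⁽ᴿˢ⁾ᵀ X        ≈⟨ refl⟩∘⟨ μ⁽ᴿˢ⁾ᵀ≈μᴿ⁽ˢᵀ⁾ X ⟩
    a X ∘ μᴿ⁽ˢᵀ⁾ X        ∎

  ρ : ∀ X → Hom (T₀ (RST₀ X)) (RST₀ X)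
  ρ X = R₁ (S₁ (μT X)) ∘ (a (T₀ X) ∘ (R₁ (λ′ (T₀ X)) ∘ τ (S₀ (T₀ X))))

  ισ∘K₁μ∘φ≈ρ∘Tισ : ∀ X → ισ (T₀ X) ∘ (F₁ K₁ (μT X) ∘ φ (T₀ X)) ≈ ρ X ∘ T₁ (ισ (T₀ X))
  ισ∘K₁μ∘φ≈ρ∘Tισ X = begin
    ισ (T₀ X) ∘ (F₁ K₁ (μT X) ∘ (πσ (T₀ (T₀ X)) ∘ (R₁ (λ′ (T₀ X)) ∘ (τ (S₀ (T₀ X)) ∘ T₁ (ισ (T₀ X))))))
      ≈⟨ extendʳ (ι-nat spσ (μT X)) ⟩
    R₁ (S₁ (μT X)) ∘ (ισ (T₀ (T₀ X)) ∘ (πσ (T₀ (T₀ X)) ∘ (R₁ (λ′ (T₀ X)) ∘ (τ (S₀ (T₀ X)) ∘ T₁ (ισ (T₀ X))))))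
      ≈⟨ refl⟩∘⟨ sym-assoc ⟩
    R₁ (S₁ (μT X)) ∘ (a (T₀ X) ∘ (R₁ (λ′ (T₀ X)) ∘ (τ (S₀ (T₀ X)) ∘ T₁ (ισ (T₀ X)))))
      ≈⟨ assoc³ ⟨
    ρ X ∘ T₁ (ισ (T₀ X)) ∎

  module Comparison {K : Endofunctor 𝒞} (sp : Splitting 𝒞 (_∘ᶠ_ 𝒞 K₁ (M T)) κφ K) where
    private
      module FK = FunctorReasoning K
      module FK₁ = FunctorReasoning K₁

    p : Fam 𝒞 RST K
    p X = π sp X ∘ πσ (T₀ X)

    j : Fam 𝒞 K RST
    j X = ισ (T₀ X) ∘ ι sp X

    j-natural : IsNatural 𝒞 K RST j
    j-natural = natural-∘ K (_∘ᶠ_ 𝒞 K₁ (M T)) RST (natural-whiskerʳ K₁ RS₁ (M T) (ι-nat spσ)) (ι-nat sp)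

    aba-splitting : Splitting 𝒞 RST aba K
    aba-splitting = record
      { π = p
      ; π-nat = natural-∘ RST (_∘ᶠ_ 𝒞 K₁ (M T)) K (π-nat sp) (natural-whiskerʳ RS₁ K₁ (M T) (π-nat spσ))
      ; ι = j
      ; ι-nat = j-natural
      ; ι∘π = λ X → trans (pullʳ (pullˡ (ι∘π sp X))) (ισ∘κφ∘πσ≈aba X)
      ; π∘ι = λ X → trans (pullʳ (cancelˡ (π∘ι spσ (T₀ X)))) (π∘ι sp X)
      }

    p∘aba≈p : ∀ X {A} {f : Hom A (RST₀ X)} → p X ∘ (a X ∘ (b X ∘ (a X ∘ f))) ≈ p X ∘ f
    p∘aba≈p X = trans (refl⟩∘⟨ trans (refl⟩∘⟨ sym-assoc) sym-assoc) (pullˡ (π∘κ≈π aba-splitting X))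

    aba∘j≈j : ∀ X → a X ∘ (b X ∘ (a X ∘ j X)) ≈ j X
    aba∘j≈j X = trans (trans (refl⟩∘⟨ sym-assoc) sym-assoc) (κ∘ι≈ι aba-splitting X)

    ψ-splitting : Splitting 𝒞 (_∘ᶠ_ 𝒞 (M R) K₂) κψ K
    ψ-splitting = record
      { π = π′
      ; π-nat = natural-∘ (_∘ᶠ_ 𝒞 (M R) K₂) RST K (π-nat aba-splitting)
                  (natural-whiskerˡ K₂ (_∘ᶠ_ 𝒞 (M S) (M T)) (M R) (ι-nat spλ))
      ; ι = ι′
      ; ι-nat = natural-∘ K RST (_∘ᶠ_ 𝒞 (M R) K₂) (natural-whiskerˡ (_∘ᶠ_ 𝒞 (M S) (M T)) K₂ (M R) (π-nat spλ)) j-natural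
      ; ι∘π = ι′∘π′≈κψ
      ; π∘ι = π′∘ι′≈id
      }
      where
      π′ : Fam 𝒞 (_∘ᶠ_ 𝒞 (M R) K₂) K
      π′ X = p X ∘ R₁ (ιλ X)

      ι′ : Fam 𝒞 K (_∘ᶠ_ 𝒞 (M R) K₂)
      ι′ X = R₁ (πλ X) ∘ j X

      π′∘ι′≈id : ∀ X → π′ X ∘ ι′ X ≈ id
      π′∘ι′≈id X = begin
        (p X ∘ R₁ (ιλ X)) ∘ (R₁ (πλ X) ∘ j X)                           ≈⟨ pullʳ (pullˡ (Rι∘Rπ≈b X)) ⟩
        p X ∘ (b X ∘ j X)                                                ≈⟨ refl⟩∘⟨ refl⟩∘⟨ aba∘j≈j X ⟨
        p X ∘ (b X ∘ (a X ∘ (b X ∘ (a X ∘ j X))))                        ≈⟨ p∘aba≈p X ⟨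
        p X ∘ (a X ∘ (b X ∘ (a X ∘ (b X ∘ (a X ∘ (b X ∘ (a X ∘ j X))))))) ≈⟨ refl⟩∘⟨ abababa≈aba X ⟩
        p X ∘ (a X ∘ (b X ∘ (a X ∘ j X)))                                ≈⟨ refl⟩∘⟨ aba∘j≈j X ⟩
        p X ∘ j X                                                        ≈⟨ π∘ι aba-splitting X ⟩
        id                                                               ∎

      ι′∘π′≈κψ : ∀ X → ι′ X ∘ π′ X ≈ κψ X
      ι′∘π′≈κψ X = begin
        (R₁ (πλ X) ∘ j X) ∘ (p X ∘ R₁ (ιλ X))
          ≈⟨ pullʳ (trans sym-assoc (ι∘π aba-splitting X ⟩∘⟨refl)) ⟩
        R₁ (πλ X) ∘ ((a X ∘ (b X ∘ a X)) ∘ R₁ (ιλ X))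
          ≈⟨ refl⟩∘⟨ trans assoc (refl⟩∘⟨ assoc) ⟩
        R₁ (πλ X) ∘ (a X ∘ (b X ∘ (a X ∘ R₁ (ιλ X))))
          ≈⟨ pullˡ Rπ∘b≈Rπ ⟨
        R₁ (πλ X) ∘ (b X ∘ (a X ∘ (b X ∘ (a X ∘ R₁ (ιλ X)))))
          ≈⟨ refl⟩∘⟨ refl⟩∘⟨ refl⟩∘⟨ refl⟩∘⟨ refl⟩∘⟨ b∘Rι≈Rι ⟨
        R₁ (πλ X) ∘ (b X ∘ (a X ∘ (b X ∘ (a X ∘ (b X ∘ R₁ (ιλ X))))))
          ≈⟨ refl⟩∘⟨ refl⟩∘⟨ abab≈ab X ⟩
        R₁ (πλ X) ∘ (b X ∘ (a X ∘ (b X ∘ R₁ (ιλ X))))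
          ≈⟨ refl⟩∘⟨ trans (Rι∘κψ∘Rπ≈bab X ⟩∘⟨refl) (trans assoc (refl⟩∘⟨ assoc)) ⟨
        R₁ (πλ X) ∘ ((R₁ (ιλ X) ∘ (κψ X ∘ R₁ (πλ X))) ∘ R₁ (ιλ X))
          ≈⟨ trans (refl⟩∘⟨ assoc) sym-assoc ⟩
        (R₁ (πλ X) ∘ R₁ (ιλ X)) ∘ ((κψ X ∘ R₁ (πλ X)) ∘ R₁ (ιλ X))
          ≈⟨ elimˡ (FR.resp-retract (π∘ι spλ X)) ⟩
        (κψ X ∘ R₁ (πλ X)) ∘ R₁ (ιλ X)
          ≈⟨ trans assoc (elimʳ (FR.resp-retract (π∘ι spλ X))) ⟩
        κψ X ∎
        where
        Rπ∘b≈Rπ : R₁ (πλ X) ∘ b X ≈ R₁ (πλ X)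
        Rπ∘b≈Rπ = FR.resp-triangle (π∘κ≈π spλ X)

        b∘Rι≈Rι : b X ∘ R₁ (ιλ X) ≈ R₁ (ιλ X)
        b∘Rι≈Rι = FR.resp-triangle (κ∘ι≈ι spλ X)

    jj : ∀ X → Hom (F₀ K (F₀ K X)) (RST₀ (RST₀ X))
    jj X = j (RST₀ X) ∘ F₁ K (j X)

    unit-eq : ∀ X → unit (weakComposite 𝒞 RS T φ sp) X ≈ unit (weakComposite 𝒞 R ST ψ ψ-splitting) X
    unit-eq X = begin
      π sp X ∘ (F₁ K₁ (ηT X) ∘ (πσ X ∘ (R₁ (ηS X) ∘ ηR X)))
        ≈⟨ refl⟩∘⟨ extendʳ (sym (π-nat spσ (ηT X))) ⟩
      π sp X ∘ (πσ (T₀ X) ∘ (R₁ (S₁ (ηT X)) ∘ (R₁ (ηS X) ∘ ηR X)))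
        ≈⟨ trans sym-assoc (refl⟩∘⟨ pullˡ FR.resp-∘) ⟩
      p X ∘ (R₁ (ηˢᵗ X) ∘ ηR X)
        ≈⟨ refl⟩∘⟨ pullˡ (FR.resp-triangle (STᶜ.ι∘unit≈ηᴬᴮ X)) ⟨
      p X ∘ (R₁ (ιλ X) ∘ (R₁ (unit ST X) ∘ ηR X))
        ≈⟨ sym-assoc ⟩
      (p X ∘ R₁ (ιλ X)) ∘ (R₁ (unit ST X) ∘ ηR X) ∎

    multφ : ∀ X → mult (weakComposite 𝒞 RS T φ sp) X ≈ p X ∘ (μ⁽ᴿˢ⁾ᵀ X ∘ jj X)
    multφ X = begin
      π sp X ∘ ((mult RS (T₀ X) ∘ F₁ K₁ (F₁ K₁ (μT X))) ∘ (F₁ K₁ (φ (T₀ X)) ∘ (ι sp (F₀ K₁ (T₀ X)) ∘ F₁ K (ι sp X))))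
        ≈⟨ trans (refl⟩∘⟨ trans assoc (trans assoc (refl⟩∘⟨ trans assoc (refl⟩∘⟨ trans assoc (refl⟩∘⟨ assoc))))) sym-assoc ⟩
      p X ∘ ((μR _ ∘ R₁ (R₁ (μS _))) ∘ (R₁ (σ _) ∘ (ισ (RST₀ X) ∘ (F₁ K₁ (ισ (T₀ X)) ∘ (F₁ K₁ (F₁ K₁ (μT X)) ∘ (F₁ K₁ (φ (T₀ X)) ∘ (ι sp (F₀ K₁ (T₀ X)) ∘ F₁ K (ι sp X))))))))
        ≈⟨ refl⟩∘⟨ trans assoc (pull₃ˡ refl) ⟩
      p X ∘ (μʳˢ (T₀ X) ∘ (ισ (RST₀ X) ∘ (F₁ K₁ (ισ (T₀ X)) ∘ (F₁ K₁ (F₁ K₁ (μT X)) ∘ (F₁ K₁ (φ (T₀ X)) ∘ (ι sp (F₀ K₁ (T₀ X)) ∘ F₁ K (ι sp X)))))))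
        ≈⟨ refl⟩∘⟨ refl⟩∘⟨ refl⟩∘⟨ pull₃ˡ (trans FK₁.resp-∘₃ (trans (FK₁.resp-≈ (ισ∘K₁μ∘φ≈ρ∘Tισ X)) FK₁.resp-∘˘)) ⟩
      p X ∘ (μʳˢ (T₀ X) ∘ (ισ (RST₀ X) ∘ ((F₁ K₁ (ρ X) ∘ F₁ K₁ (T₁ (ισ (T₀ X)))) ∘ (ι sp (F₀ K₁ (T₀ X)) ∘ F₁ K (ι sp X)))))
        ≈⟨ refl⟩∘⟨ refl⟩∘⟨ refl⟩∘⟨ trans assoc (refl⟩∘⟨ extendʳ (sym (ι-nat sp (ισ (T₀ X))))) ⟩
      p X ∘ (μʳˢ (T₀ X) ∘ (ισ (RST₀ X) ∘ (F₁ K₁ (ρ X) ∘ (ι sp (RST₀ X) ∘ (F₁ K (ισ (T₀ X)) ∘ F₁ K (ι sp X))))))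
        ≈⟨ refl⟩∘⟨ refl⟩∘⟨ extendʳ (ι-nat spσ (ρ X)) ⟩
      p X ∘ (μʳˢ (T₀ X) ∘ (R₁ (S₁ (ρ X)) ∘ (ισ (T₀ (RST₀ X)) ∘ (ι sp (RST₀ X) ∘ (F₁ K (ισ (T₀ X)) ∘ F₁ K (ι sp X))))))
        ≈⟨ refl⟩∘⟨ refl⟩∘⟨ refl⟩∘⟨ trans sym-assoc (refl⟩∘⟨ FK.resp-∘) ⟩
      p X ∘ (μʳˢ (T₀ X) ∘ (R₁ (S₁ (ρ X)) ∘ jj X))
        ≈⟨ refl⟩∘⟨ refl⟩∘⟨ trans FRS.resp-∘˘ (refl⟩∘⟨ FRS.resp-∘˘) ⟩∘⟨refl ⟩
      p X ∘ (μʳˢ (T₀ X) ∘ ((R₁ (S₁ (R₁ (S₁ (μT X)))) ∘ (R₁ (S₁ (a (T₀ X))) ∘ R₁ (S₁ (R₁ (λ′ (T₀ X)) ∘ τ (S₀ (T₀ X)))))) ∘ jj X))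
        ≈⟨ refl⟩∘⟨ refl⟩∘⟨ trans assoc (refl⟩∘⟨ assoc) ⟩
      p X ∘ (μʳˢ (T₀ X) ∘ (R₁ (S₁ (R₁ (S₁ (μT X)))) ∘ (R₁ (S₁ (a (T₀ X))) ∘ (R₁ (S₁ (R₁ (λ′ (T₀ X)) ∘ τ (S₀ (T₀ X)))) ∘ jj X))))
        ≈⟨ refl⟩∘⟨ extendʳ (Wσ.μᴬᴮ-natural (μT X)) ⟩
      p X ∘ (R₁ (S₁ (μT X)) ∘ (μʳˢ (T₀ (T₀ X)) ∘ (R₁ (S₁ (a (T₀ X))) ∘ (R₁ (S₁ (R₁ (λ′ (T₀ X)) ∘ τ (S₀ (T₀ X)))) ∘ jj X))))
        ≈⟨ refl⟩∘⟨ refl⟩∘⟨ pullˡ (trans (refl⟩∘⟨ FRS.resp-≈ (ι∘π spσ _)) (Wσ.μᴬᴮ-absorbs-κ _)) ⟩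
      p X ∘ (R₁ (S₁ (μT X)) ∘ (μʳˢ (T₀ (T₀ X)) ∘ (R₁ (S₁ (R₁ (λ′ (T₀ X)) ∘ τ (S₀ (T₀ X)))) ∘ jj X)))
        ≈⟨ refl⟩∘⟨ refl⟩∘⟨ refl⟩∘⟨ (FRS.resp-∘˘ ⟩∘⟨refl) ⟩
      p X ∘ (R₁ (S₁ (μT X)) ∘ (μʳˢ (T₀ (T₀ X)) ∘ ((R₁ (S₁ (R₁ (λ′ (T₀ X)))) ∘ R₁ (S₁ (τ (S₀ (T₀ X))))) ∘ jj X)))
        ≈⟨ refl⟩∘⟨ trans (refl⟩∘⟨ refl⟩∘⟨ assoc) (sym assoc³) ⟩
      p X ∘ (μ⁽ᴿˢ⁾ᵀ X ∘ jj X) ∎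

    multψ : ∀ X → mult (weakComposite 𝒞 R ST ψ ψ-splitting) X ≈ p X ∘ (b X ∘ (μᴿ⁽ˢᵀ⁾ X ∘ jj X))
    multψ X = trans lhs≈middle middle≈rhs
      where
      middle : Hom (F₀ K (F₀ K X)) (F₀ K X)
      middle = p X ∘ (μR (S₀ (T₀ X)) ∘ (R₁ (R₁ (κλ X ∘ μˢᵗ X)) ∘ (R₁ (Ψ (S₀ (T₀ X))) ∘ (b (RST₀ X) ∘ (R₁ (S₁ (T₁ (b X))) ∘ jj X)))))

      lhs≈middle : mult (weakComposite 𝒞 R ST ψ ψ-splitting) X ≈ middle
      lhs≈middle = begin
        (p X ∘ R₁ (ιλ X)) ∘ ((μR (F₀ K₂ X) ∘ R₁ (R₁ (mult ST X))) ∘ (R₁ (ψ (F₀ K₂ X)) ∘ (ι ψ-splitting (R₀ (F₀ K₂ X)) ∘ F₁ K (ι ψ-splitting X))))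
          ≈⟨ trans assoc (refl⟩∘⟨ refl⟩∘⟨ assoc) ⟩
        p X ∘ (R₁ (ιλ X) ∘ (μR (F₀ K₂ X) ∘ (R₁ (R₁ (mult ST X)) ∘ (R₁ (ψ (F₀ K₂ X)) ∘ (ι ψ-splitting (R₀ (F₀ K₂ X)) ∘ F₁ K (ι ψ-splitting X))))))
          ≈⟨ refl⟩∘⟨ extendʳ (sym (mR.mult-nat (ιλ X))) ⟩
        p X ∘ (μR (S₀ (T₀ X)) ∘ (R₁ (R₁ (ιλ X)) ∘ (R₁ (R₁ (mult ST X)) ∘ (R₁ (ψ (F₀ K₂ X)) ∘ (ι ψ-splitting (R₀ (F₀ K₂ X)) ∘ F₁ K (ι ψ-splitting X))))))
          ≈⟨ refl⟩∘⟨ refl⟩∘⟨ pullˡ FRR.resp-∘ ⟩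
        p X ∘ (μR (S₀ (T₀ X)) ∘ (R₁ (R₁ (ιλ X ∘ mult ST X)) ∘ (R₁ (ψ (F₀ K₂ X)) ∘ (ι ψ-splitting (R₀ (F₀ K₂ X)) ∘ F₁ K (ι ψ-splitting X)))))
          ≈⟨ refl⟩∘⟨ refl⟩∘⟨ pullˡ (FR.resp-triangle (Rι∘Rmult∘ψ X)) ⟩
        p X ∘ (μR (S₀ (T₀ X)) ∘ (R₁ (R₁ (κλ X ∘ μˢᵗ X) ∘ (Ψ (S₀ (T₀ X)) ∘ (ιλ (RST₀ X) ∘ F₁ K₂ (R₁ (ιλ X))))) ∘ (ι ψ-splitting (R₀ (F₀ K₂ X)) ∘ F₁ K (ι ψ-splitting X))))
          ≈⟨ refl⟩∘⟨ refl⟩∘⟨ trans (trans FR.resp-∘˘ (refl⟩∘⟨ trans FR.resp-∘˘ (refl⟩∘⟨ FR.resp-∘˘)) ⟩∘⟨refl) assoc³ ⟩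
        p X ∘ (μR (S₀ (T₀ X)) ∘ (R₁ (R₁ (κλ X ∘ μˢᵗ X)) ∘ (R₁ (Ψ (S₀ (T₀ X))) ∘ (R₁ (ιλ (RST₀ X)) ∘ (R₁ (F₁ K₂ (R₁ (ιλ X))) ∘ (ι ψ-splitting (R₀ (F₀ K₂ X)) ∘ F₁ K (ι ψ-splitting X)))))))
          ≈⟨ refl⟩∘⟨ refl⟩∘⟨ refl⟩∘⟨ refl⟩∘⟨ refl⟩∘⟨ trans (refl⟩∘⟨ assoc) (extendʳ (FR.resp-square (sym (π-nat spλ (R₁ (ιλ X)))))) ⟩
        p X ∘ (μR (S₀ (T₀ X)) ∘ (R₁ (R₁ (κλ X ∘ μˢᵗ X)) ∘ (R₁ (Ψ (S₀ (T₀ X))) ∘ (R₁ (ιλ (RST₀ X)) ∘ (R₁ (πλ (RST₀ X)) ∘ (R₁ (S₁ (T₁ (R₁ (ιλ X)))) ∘ (j (R₀ (F₀ K₂ X)) ∘ F₁ K (ι ψ-splitting X))))))))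
          ≈⟨ refl⟩∘⟨ refl⟩∘⟨ refl⟩∘⟨ refl⟩∘⟨ pullˡ (Rι∘Rπ≈b _) ⟩
        p X ∘ (μR (S₀ (T₀ X)) ∘ (R₁ (R₁ (κλ X ∘ μˢᵗ X)) ∘ (R₁ (Ψ (S₀ (T₀ X))) ∘ (b (RST₀ X) ∘ (R₁ (S₁ (T₁ (R₁ (ιλ X)))) ∘ (j (R₀ (F₀ K₂ X)) ∘ F₁ K (ι ψ-splitting X)))))))
          ≈⟨ refl⟩∘⟨ refl⟩∘⟨ refl⟩∘⟨ refl⟩∘⟨ refl⟩∘⟨ extendʳ (sym (j-natural (R₁ (ιλ X)))) ⟩
        p X ∘ (μR (S₀ (T₀ X)) ∘ (R₁ (R₁ (κλ X ∘ μˢᵗ X)) ∘ (R₁ (Ψ (S₀ (T₀ X))) ∘ (b (RST₀ X) ∘ (j (RST₀ X) ∘ (F₁ K (R₁ (ιλ X)) ∘ F₁ K (ι ψ-splitting X)))))))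
          ≈⟨ refl⟩∘⟨ refl⟩∘⟨ refl⟩∘⟨ refl⟩∘⟨ refl⟩∘⟨ refl⟩∘⟨ FK.resp-square (pullˡ (Rι∘Rπ≈b X)) ⟩
        p X ∘ (μR (S₀ (T₀ X)) ∘ (R₁ (R₁ (κλ X ∘ μˢᵗ X)) ∘ (R₁ (Ψ (S₀ (T₀ X))) ∘ (b (RST₀ X) ∘ (j (RST₀ X) ∘ (F₁ K (b X) ∘ F₁ K (j X)))))))
          ≈⟨ refl⟩∘⟨ refl⟩∘⟨ refl⟩∘⟨ refl⟩∘⟨ refl⟩∘⟨ extendʳ (j-natural (b X)) ⟩
        middle ∎

      middle≈rhs : middle ≈ p X ∘ (b X ∘ (μᴿ⁽ˢᵀ⁾ X ∘ jj X))
      middle≈rhs = begin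
        middle
          ≈⟨ refl⟩∘⟨ refl⟩∘⟨ (FRR.resp-∘˘ ⟩∘⟨refl) ⟩
        p X ∘ (μR (S₀ (T₀ X)) ∘ ((R₁ (R₁ (κλ X)) ∘ R₁ (R₁ (μˢᵗ X))) ∘ (R₁ (Ψ (S₀ (T₀ X))) ∘ (b (RST₀ X) ∘ (R₁ (S₁ (T₁ (b X))) ∘ jj X)))))
          ≈⟨ refl⟩∘⟨ refl⟩∘⟨ assoc ⟩
        p X ∘ (μR (S₀ (T₀ X)) ∘ (R₁ (R₁ (κλ X)) ∘ (R₁ (R₁ (μˢᵗ X)) ∘ (R₁ (Ψ (S₀ (T₀ X))) ∘ (b (RST₀ X) ∘ (R₁ (S₁ (T₁ (b X))) ∘ jj X))))))
          ≈⟨ refl⟩∘⟨ extendʳ (mR.mult-nat (κλ X)) ⟩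
        p X ∘ (b X ∘ (μR (S₀ (T₀ X)) ∘ (R₁ (R₁ (μˢᵗ X)) ∘ (R₁ (Ψ (S₀ (T₀ X))) ∘ (b (RST₀ X) ∘ (R₁ (S₁ (T₁ (b X))) ∘ jj X))))))
          ≈⟨ refl⟩∘⟨ refl⟩∘⟨ pull₃ˡ refl ⟩
        p X ∘ (b X ∘ (μᴿ⁽ˢᵀ⁾ X ∘ (b (RST₀ X) ∘ (R₁ (S₁ (T₁ (b X))) ∘ jj X))))
          ≈⟨ refl⟩∘⟨ refl⟩∘⟨ extendʳ (μᴿ⁽ˢᵀ⁾∘b≈b∘μᴿ⁽ˢᵀ⁾ X) ⟩
        p X ∘ (b X ∘ (b X ∘ (μᴿ⁽ˢᵀ⁾ X ∘ (R₁ (S₁ (T₁ (b X))) ∘ jj X))))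
          ≈⟨ refl⟩∘⟨ pullˡ (b-idempotent X) ⟩
        p X ∘ (b X ∘ (μᴿ⁽ˢᵀ⁾ X ∘ (R₁ (S₁ (T₁ (b X))) ∘ jj X)))
          ≈⟨ refl⟩∘⟨ refl⟩∘⟨ pullˡ (μᴿ⁽ˢᵀ⁾∘RSTb≈μᴿ⁽ˢᵀ⁾ X) ⟩
        p X ∘ (b X ∘ (μᴿ⁽ˢᵀ⁾ X ∘ jj X)) ∎

    aba-fixes-μᴿ⁽ˢᵀ⁾∘jj : ∀ X → μᴿ⁽ˢᵀ⁾ X ∘ jj X ≈ a X ∘ (b X ∘ (a X ∘ (μᴿ⁽ˢᵀ⁾ X ∘ jj X)))
    aba-fixes-μᴿ⁽ˢᵀ⁾∘jj X = begin
      μᴿ⁽ˢᵀ⁾ X ∘ (j (RST₀ X) ∘ F₁ K (j X))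
        ≈⟨ refl⟩∘⟨ trans (refl⟩∘⟨ refl⟩∘⟨ sym-assoc) (pull₃ˡ (aba∘j≈j (RST₀ X))) ⟨
      μᴿ⁽ˢᵀ⁾ X ∘ (a (RST₀ X) ∘ (b (RST₀ X) ∘ (a (RST₀ X) ∘ (j (RST₀ X) ∘ F₁ K (j X)))))
        ≈⟨ extendʳ (μᴿ⁽ˢᵀ⁾∘a≈a∘μᴿ⁽ˢᵀ⁾ X) ⟩
      a X ∘ (μᴿ⁽ˢᵀ⁾ X ∘ (b (RST₀ X) ∘ (a (RST₀ X) ∘ (j (RST₀ X) ∘ F₁ K (j X)))))
        ≈⟨ refl⟩∘⟨ extendʳ (μᴿ⁽ˢᵀ⁾∘b≈b∘μᴿ⁽ˢᵀ⁾ X) ⟩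
      a X ∘ (b X ∘ (μᴿ⁽ˢᵀ⁾ X ∘ (a (RST₀ X) ∘ (j (RST₀ X) ∘ F₁ K (j X)))))
        ≈⟨ refl⟩∘⟨ refl⟩∘⟨ extendʳ (μᴿ⁽ˢᵀ⁾∘a≈a∘μᴿ⁽ˢᵀ⁾ X) ⟩
      a X ∘ (b X ∘ (a X ∘ (μᴿ⁽ˢᵀ⁾ X ∘ (j (RST₀ X) ∘ F₁ K (j X))))) ∎

    mult-eq : ∀ X → mult (weakComposite 𝒞 RS T φ sp) X ≈ mult (weakComposite 𝒞 R ST ψ ψ-splitting) X
    mult-eq X = begin
      mult (weakComposite 𝒞 RS T φ sp) X
        ≈⟨ multφ X ⟩
      p X ∘ (μ⁽ᴿˢ⁾ᵀ X ∘ jj X)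
        ≈⟨ refl⟩∘⟨ μ⁽ᴿˢ⁾ᵀ≈μᴿ⁽ˢᵀ⁾ X ⟩∘⟨refl ⟩
      p X ∘ (μᴿ⁽ˢᵀ⁾ X ∘ jj X)
        ≈⟨ p∘aba≈p X ⟨
      p X ∘ (a X ∘ (b X ∘ (a X ∘ (μᴿ⁽ˢᵀ⁾ X ∘ jj X))))
        ≈⟨ refl⟩∘⟨ abababa≈aba X ⟨
      p X ∘ (a X ∘ (b X ∘ (a X ∘ (b X ∘ (a X ∘ (b X ∘ (a X ∘ (μᴿ⁽ˢᵀ⁾ X ∘ jj X))))))))
        ≈⟨ p∘aba≈p X ⟩
      p X ∘ (b X ∘ (a X ∘ (b X ∘ (a X ∘ (μᴿ⁽ˢᵀ⁾ X ∘ jj X)))))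
        ≈⟨ refl⟩∘⟨ refl⟩∘⟨ aba-fixes-μᴿ⁽ˢᵀ⁾∘jj X ⟨
      p X ∘ (b X ∘ (μᴿ⁽ˢᵀ⁾ X ∘ jj X))
        ≈⟨ multψ X ⟨
      mult (weakComposite 𝒞 R ST ψ ψ-splitting) X ∎

-- Idempotent completeness only guarantees that the splittings exist; here they are given.
theorem4p6 : ∀ {o ℓ e} (𝒞 : Category o ℓ e) → IdempotentComplete 𝒞 →
  let open Category 𝒞 in
  (R S T : MonadData 𝒞) → IsMonad 𝒞 R → IsMonad 𝒞 S → IsMonad 𝒞 T →
  (λ' : Fam 𝒞 (_∘ᶠ_ 𝒞 (M T) (M S)) (_∘ᶠ_ 𝒞 (M S) (M T))) →
  (σ : Fam 𝒞 (_∘ᶠ_ 𝒞 (M S) (M R)) (_∘ᶠ_ 𝒞 (M R) (M S))) →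
  (τ : Fam 𝒞 (_∘ᶠ_ 𝒞 (M T) (M R)) (_∘ᶠ_ 𝒞 (M R) (M T))) →
  IsWeakDistributiveLaw 𝒞 S T λ' → IsWeakDistributiveLaw 𝒞 R S σ → IsDistributiveLaw 𝒞 R T τ →
  (∀ X → σ (F₀ (M T) X) ∘ (F₁ (M S) (τ X) ∘ λ' (F₀ (M R) X))
         ≈ F₁ (M R) (λ' X) ∘ (τ (F₀ (M S) X) ∘ F₁ (M T) (σ X))) →
  (K₁ : Endofunctor 𝒞) (spσ : Splitting 𝒞 (_∘ᶠ_ 𝒞 (M R) (M S)) (κ 𝒞 R S σ) K₁) →
  (K₂ : Endofunctor 𝒞) (spλ : Splitting 𝒞 (_∘ᶠ_ 𝒞 (M S) (M T)) (κ 𝒞 S T λ') K₂) →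
  let RS = weakComposite 𝒞 R S σ spσ
      ST = weakComposite 𝒞 S T λ' spλ
      φ : Fam 𝒞 (_∘ᶠ_ 𝒞 (M T) K₁) (_∘ᶠ_ 𝒞 K₁ (M T))
      φ X = π spσ (F₀ (M T) X) ∘ (F₁ (M R) (λ' X)
              ∘ (τ (F₀ (M S) X) ∘ F₁ (M T) (ι spσ X)))
      ψ : Fam 𝒞 (_∘ᶠ_ 𝒞 K₂ (M R)) (_∘ᶠ_ 𝒞 (M R) K₂)
      ψ X = F₁ (M R) (π spλ X) ∘ (σ (F₀ (M T) X)
              ∘ (F₁ (M S) (τ X) ∘ ι spλ (F₀ (M R) X)))
  in
  (K : Endofunctor 𝒞) (sp : Splitting 𝒞 (_∘ᶠ_ 𝒞 K₁ (M T)) (κ 𝒞 RS T φ) K) →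
  Σ (Splitting 𝒞 (_∘ᶠ_ 𝒞 (M R) K₂) (κ 𝒞 R ST ψ) K) λ sp' →
    (∀ X → unit (weakComposite 𝒞 RS T φ sp) X ≈ unit (weakComposite 𝒞 R ST ψ sp') X)
    × (∀ X → mult (weakComposite 𝒞 RS T φ sp) X ≈ mult (weakComposite 𝒞 R ST ψ sp') X)
theorem4p6 𝒞 _ _ _ _ R-monad S-monad T-monad _ _ _ wλ wσ dτ yang-baxter _ spσ _ spλ _ sp =
  ψ-splitting , unit-eq , mult-eq
  where
  open YangBaxterComposites 𝒞 R-monad S-monad T-monad wλ wσ dτ yang-baxter spσ spλ
  open Comparison sp
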